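{- For integers $r\ge 3$ and $q\ge 4$, let $H=K^{2,q}(K_r)$. Then $\operatorname{pd}(H)=r-1$, $\overline{\operatorname{pd}}(H)\ge q\frac{r(r-1)}{2}-(r-1)$, $\underline{pd_0}(H)=r$, and $pd_0(H)\ge q\frac{r(r-1)}{2}-(r-1)+1>r=\underline{pd_0}(H)$.
   Context: All graphs are finite, simple, undirected. Standard zero forcing: starting with a set of blue vertices (others white), a blue vertex $u$ may turn a white vertex $w$ blue if $w$ is the only white neighbor of $u$; a set $S$ is a (standard) zero forcing set if starting with exactly $S$ blue, repeated application makes all vertices blue. A set $S\subseteq V(G)$ is a power dominating set of $G$ if its closed neighborhood $N[S]=\bigcup_{x\in S}(\{x\}\cup N(x))$ is a zero forcing set. $\operatorname{pd}(G)$ is the minimum size of a power dominating set and $\overline{\operatorname{pd}}(G)$ the maximum size of an inclusion-minimal power dominating set. The power domination TAR graph $\mathfrak{P}(G)$ has the power dominating sets as vertices, two adjacent iff their symmetric difference has one element; $\mathfrak{P}_k(G)$ is its subgraph induced by power dominating sets of size at most $k$. $\underline{pd_0}(G)$ is the least $k$ such that $\mathfrak{P}_k(G)$ is connected, and $pd_0(G)$ is the least $k_0$ such that $\mathfrak{P}_k(G)$ is connected for all $k\ge k_0$. For a connected graph $H$ of order at least two and $q\ge 3$, $K^{2,q}(H)$ is obtained from $H$ by deleting each edge $uv$ of $H$ and adding $q$ new vertices, each adjacent exactly to $u$ and $v$. -}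

module Defs where

open import Data.Nat using (ℕ; zero; suc; _≤_; _<_)
open import Data.Nat.Properties using (<⇒≤)
open import Data.Fin using (Fin; toℕ; inject≤)
open import Data.Fin.Properties using (toℕ<n)
open import Data.Bool using (Bool; true; false; _xor_; if_then_else_)
open import Data.List using (List; []; _∷_; _++_; map; concatMap; length)
open import Data.List using () renaming (allFin to allFinL)
open import Data.Product using (Σ; Σ-syntax; ∃; ∃-syntax; _×_; _,_)
open import Data.Sum using (_⊎_; inj₁; inj₂)
open import Data.Empty using (⊥)
open import Relation.Binary.PropositionalEquality using (_≡_; _≢_)

-- Finite simple graphs.
-- V is the vertex type, `vs` lists every vertex exactly once (used only
-- to count the size of vertex subsets), `_~_` is adjacency.

record Graph : Set₁ where
  field
    V   : Set
    vs  : List V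
    _~_ : V → V → Set

-- Graphs given by a vertex list and an edge list (each edge listed once,
-- with its two distinct endpoints).  Used to build K^{2,q}(G).
record EdgeGraph : Set₁ where
  field
    V    : Set
    E    : Set
    vs   : List V
    es   : List E
    end₁ : E → V
    end₂ : E → V

-- The complete graph K_r: vertices Fin r, edges {i , j} with i < j,
-- encoded as a pair (j , i) with i : Fin (toℕ j) (so i < j automatically).
Kr : ℕ → EdgeGraph
Kr r = record
  { V    = Fin r
  ; E    = Σ[ j ∈ Fin r ] Fin (toℕ j)
  ; vs   = allFinL r
  ; es   = concatMap (λ j → map (λ i → (j , i)) (allFinL (toℕ j))) (allFinL r)
  ; end₁ = λ { (j , i) → inject≤ i (<⇒≤ (toℕ<n j)) }
  ; end₂ = λ { (j , i) → j }
  }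

-- K^{2,q}(G): delete every edge uv of G and add q new vertices (e , k),
-- k : Fin q, each adjacent exactly to u and v.
K2q : EdgeGraph → ℕ → Graph
K2q G q = record
  { V   = V ⊎ (E × Fin q)
  ; vs  = map inj₁ vs ++ concatMap (λ e → map (λ k → inj₂ (e , k)) (allFinL q)) es
  ; _~_ = adj
  }
  where
    open EdgeGraph G
    adj : V ⊎ (E × Fin q) → V ⊎ (E × Fin q) → Set
    adj (inj₁ u)       (inj₁ v)       = ⊥
    adj (inj₁ u)       (inj₂ (e , k)) = (u ≡ end₁ e) ⊎ (u ≡ end₂ e)
    adj (inj₂ (e , k)) (inj₁ u)       = (u ≡ end₁ e) ⊎ (u ≡ end₂ e)
    adj (inj₂ _)       (inj₂ _)       = ⊥

module _ (G : Graph) where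
  open Graph G

  VSet : Set
  VSet = V → Bool

  count : List V → VSet → ℕ
  count []       S = 0
  count (v ∷ ws) S = if S v then suc (count ws S) else count ws S

  ∣_∣ : VSet → ℕ
  ∣ S ∣ = count vs S

  _⊆_ : VSet → VSet → Set
  S ⊆ T = ∀ v → S v ≡ true → T v ≡ true

  _≐_ : VSet → VSet → Set
  S ≐ T = ∀ v → S v ≡ T v

  -- Blue B v : v is eventually blue when the vertices satisfying B are
  -- initially blue and the zero forcing (color change) rule is applied
  -- repeatedly: a blue u forces w if w is the only non-blue neighbour of u.
  data Blue (B : V → Set) : V → Set where
    init  : ∀ {v} → B v → Blue B v
    force : ∀ {u w} → Blue B u → u ~ w →
            (∀ x → u ~ x → x ≢ w → Blue B x) → Blue B w

  IsZFS : (V → Set) → Set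
  IsZFS B = ∀ v → Blue B v

  ClosedNbhd : VSet → V → Set
  ClosedNbhd S x = (S x ≡ true) ⊎ (∃[ s ] (S s ≡ true × s ~ x))

  IsPDS : VSet → Set
  IsPDS S = IsZFS (ClosedNbhd S)

  IsMinimalPDS : VSet → Set
  IsMinimalPDS S = IsPDS S × (∀ T → T ⊆ S → IsPDS T → T ≐ S)

  IsPd : ℕ → Set
  IsPd k = (∃[ S ] (IsPDS S × ∣ S ∣ ≡ k)) × (∀ S → IsPDS S → k ≤ ∣ S ∣)

  IsUpperPd : ℕ → Set
  IsUpperPd k = (∃[ S ] (IsMinimalPDS S × ∣ S ∣ ≡ k))
              × (∀ S → IsMinimalPDS S → ∣ S ∣ ≤ k)

  InPk : ℕ → VSet → Set
  InPk k S = IsPDS S × ∣ S ∣ ≤ k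

  TARAdj : VSet → VSet → Set
  TARAdj S T = ∣ (λ v → S v xor T v) ∣ ≡ 1

  data Reach (k : ℕ) : VSet → VSet → Set where
    same : ∀ {S T} → S ≐ T → Reach k S T
    step : ∀ {S T U} → Reach k S T → InPk k T → InPk k U →
           TARAdj T U → Reach k S U

  PkConnected : ℕ → Set
  PkConnected k = (∃[ S ] InPk k S)
                × (∀ S T → InPk k S → InPk k T → Reach k S T)

  IsLowerPd0 : ℕ → Set
  IsLowerPd0 k = PkConnected k × (∀ j → PkConnected j → k ≤ j)

  IsPd0 : ℕ → Set
  IsPd0 k₀ = (∀ k → k₀ ≤ k → PkConnected k)
           × (∀ k₁ → (∀ k → k₁ ≤ k → PkConnected k) → k₀ ≤ k₁)

module Submission where

-- Two subdivision vertices of one edge uv of K_r form a fort, so a power dominating set avoiding u and v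
-- contains all but at most one of the q subdivision vertices of uv.  Hence a PDS missing an original a
-- contains, for every b ≠ a, either b or a subdivision vertex of ab: pd = r − 1, attained by all originals
-- but one.  With q ≥ 4 a PDS of size at most r misses at most one original, so every vertex of 𝔓_r reaches
-- the set of all originals, whereas "all originals but one" is isolated in 𝔓_{r−1}: the least k with 𝔓_k
-- connected is r.
-- The set M of all subdivision vertices except one on each edge at vertex 0 is a minimal PDS (removing a
-- vertex leaves a fort of two vertices on an edge at 0, or of three vertices around a triangle through 0)
-- of size q·C(r,2) − (r − 1).  A largest minimal PDS is isolated in 𝔓_k for k = pd‾, while 𝔓_k also
-- contains smaller PDSs, so pd₀ > pd‾.  Both pd‾ and pd₀ exist because on a finite graph power domination
-- and reachability in 𝔓_k are decidable.

open import Defs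
open import Data.Bool using (Bool; true; false; if_then_else_; not; _xor_)
import Data.Bool.Properties as Bool
open import Data.Empty using (⊥-elim)
open import Data.Fin as Fin using (Fin; toℕ; fromℕ<; punchIn)
open import Data.Fin.Properties using (toℕ<n; toℕ-injective; toℕ-inject≤; toℕ-fromℕ<; punchIn-injective; punchInᵢ≢i)
import Data.Fin.Properties as Fin using (any?)
open import Data.List using (List; []; _∷_; _++_; map; concatMap; length; filter; allFin; tabulate)
open import Data.List.Extrema.Nat using (argmax; argmax-all; f[xs]≤f[argmax])
open import Data.List.Membership.Propositional using (_∈_; find; lose)
open import Data.List.Membership.Propositional.Properties
  using (∈-++⁺ˡ; ∈-++⁺ʳ; ∈-map⁺; ∈-map⁻; ∈-allFin; ∈-concatMap⁺; ∈-concatMap⁻; ∈-tabulate⁻; ∈-filter⁺)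
open import Data.List.Properties using (length-map; length-tabulate; length-filter; map-++; map-tabulate; map-cong; map-∘)
open import Data.List.Relation.Binary.Disjoint.Propositional using (Disjoint)
open import Data.List.Relation.Unary.All as All using (All; []; _∷_; all?)
import Data.List.Relation.Unary.All.Properties as All
open import Data.List.Relation.Unary.AllPairs using (_∷_)
import Data.List.Relation.Unary.AllPairs as AllPairs
import Data.List.Relation.Unary.AllPairs.Properties as AllPairs
open import Data.List.Relation.Unary.Any as Any using (Any; here; there; any?)
open import Data.List.Relation.Unary.Unique.Propositional using (Unique)
import Data.List.Relation.Unary.Unique.Propositional.Properties as Unique
open import Data.Nat as ℕ using (ℕ; zero; suc; _+_; _*_; _∸_; _/_; _≤_; _<_; _≤′_; ≤′-refl; ≤′-step; _≤?_; _<?_; z≤n; s≤s)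
open import Data.Nat.DivMod using (m*n/n≡m)
open import Data.Nat.Induction using (<-rec)
open import Data.Nat.ListAction using (sum)
open import Data.Nat.ListAction.Properties using (sum-++)
open import Data.Nat.Properties
  using (≤-refl; ≤-reflexive; ≤-trans; ≤-antisym; ≤-total; <-irrefl; <⇒≤; ≰⇒>; ≮⇒≥; <-cmp; n≮0; ≤⇒≤′;
         suc-injective; m≤n⇒m≤1+n; n≤1+n; m≤m+n; +-identityʳ; +-comm; +-monoʳ-≤; +-cancelʳ-≤; *-monoʳ-≤;
         *-identityʳ; *-distribʳ-+; m+n∸n≡m; allUpTo?; anyUpTo?; module ≤-Reasoning)
open import Data.Nat.Tactic.RingSolver using (solve-∀)
open import Data.Product using (Σ-syntax; ∃-syntax; _×_; _,_; proj₁; proj₂)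
import Data.Product.Properties as Product
open import Data.Sum using (_⊎_; inj₁; inj₂)
import Data.Sum.Properties as Sum
open import Function using (id)
open import Relation.Binary.Definitions using (DecidableEquality; tri<; tri≈; tri>)
open import Relation.Binary.PropositionalEquality
  using (_≡_; _≢_; refl; sym; trans; cong; cong₂; subst; module ≡-Reasoning)
open import Relation.Nullary using (¬_; Dec; yes; no; does)
open import Relation.Nullary.Decidable using (_×-dec_; _⊎-dec_; _→-dec_; ¬?; map′; decidable-stable)
open import Relation.Unary using (Decidable)

-- Counting

true≢false : true ≢ false
true≢false ()

≢⇒xor≡true : ∀ {x y} → x ≢ y → x xor y ≡ true
≢⇒xor≡true {true}  {true}  x≢y = ⊥-elim (x≢y refl)
≢⇒xor≡true {true}  {false} _   = refl
≢⇒xor≡true {false} {true}  _   = refl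
≢⇒xor≡true {false} {false} x≢y = ⊥-elim (x≢y refl)

module Counting (G : Graph) where
  open Graph G

  count-++ : ∀ xs ys S → count G (xs ++ ys) S ≡ count G xs S + count G ys S
  count-++ []       ys S = refl
  count-++ (x ∷ xs) ys S with S x
  ... | true  = cong suc (count-++ xs ys S)
  ... | false = count-++ xs ys S

  count-concatMap : ∀ {A : Set} (f : A → List V) xs S →
                    count G (concatMap f xs) S ≡ sum (map (λ x → count G (f x) S) xs)
  count-concatMap f []       S = refl
  count-concatMap f (x ∷ xs) S =
    trans (count-++ (f x) (concatMap f xs) S) (cong (count G (f x) S +_) (count-concatMap f xs S))

  count-cong : ∀ ws {S T} → (∀ {x} → x ∈ ws → S x ≡ T x) → count G ws S ≡ count G ws T
  count-cong []       S≗T = refl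
  count-cong (v ∷ ws) {S} {T} S≗T with S v | T v | S≗T (here refl)
  ... | true  | true  | _ = cong suc (count-cong ws (λ m → S≗T (there m)))
  ... | false | false | _ = count-cong ws (λ m → S≗T (there m))

  count-mono : ∀ ws {S T} → _⊆_ G S T → count G ws S ≤ count G ws T
  count-mono []       S⊆T = z≤n
  count-mono (v ∷ ws) {S} {T} S⊆T with S v in S[v] | T v in T[v]
  ... | true  | true  = s≤s (count-mono ws S⊆T)
  ... | true  | false with () ← trans (sym (S⊆T v S[v])) T[v]
  ... | false | true  = m≤n⇒m≤1+n (count-mono ws S⊆T)
  ... | false | false = count-mono ws S⊆T

  count-< : ∀ {ws S T} → _⊆_ G S T → ∀ {x} → x ∈ ws → S x ≡ false → T x ≡ true →
            count G ws S < count G ws T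
  count-< {v ∷ ws} S⊆T (here refl) S[x] T[x] rewrite S[x] | T[x] = s≤s (count-mono ws S⊆T)
  count-< {v ∷ ws} {S} {T} S⊆T (there x∈ws) S[x] T[x] with S v in S[v] | T v in T[v]
  ... | true  | true  = s≤s (count-< S⊆T x∈ws S[x] T[x])
  ... | true  | false with () ← trans (sym (S⊆T v S[v])) T[v]
  ... | false | true  = m≤n⇒m≤1+n (count-< S⊆T x∈ws S[x] T[x])
  ... | false | false = count-< S⊆T x∈ws S[x] T[x]

  count≤length : ∀ ws S → count G ws S ≤ length ws
  count≤length []       S = z≤n
  count≤length (v ∷ ws) S with S v
  ... | true  = s≤s (count≤length ws S)
  ... | false = m≤n⇒m≤1+n (count≤length ws S)

  count-all-false : ∀ {ws S} → (∀ {x} → x ∈ ws → S x ≡ false) → count G ws S ≡ 0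
  count-all-false {[]}     none = refl
  count-all-false {v ∷ ws} none rewrite none (here refl) = count-all-false (λ m → none (there m))

  count-all-true : ∀ {ws S} → (∀ {x} → x ∈ ws → S x ≡ true) → count G ws S ≡ length ws
  count-all-true {[]}     all = refl
  count-all-true {v ∷ ws} all rewrite all (here refl) = cong suc (count-all-true (λ m → all (there m)))

  count≡0⇒false : ∀ {ws S x} → count G ws S ≡ 0 → x ∈ ws → S x ≡ false
  count≡0⇒false {v ∷ ws} {S} c≡0 x∈ws with S v in S[v]
  count≡0⇒false c≡0 (here refl)  | false = S[v]
  count≡0⇒false c≡0 (there x∈ws) | false = count≡0⇒false c≡0 x∈ws

  count≡1⇒unique : ∀ {ws S} → count G ws S ≡ 1 →
                   ∃[ v ] (S v ≡ true × ∀ {w} → w ∈ ws → S w ≡ true → w ≡ v)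
  count≡1⇒unique {v ∷ ws} {S} c≡1 with S v in S[v]
  ... | true  = v , S[v] , only-v
    where
      only-v : ∀ {w} → w ∈ v ∷ ws → S w ≡ true → w ≡ v
      only-v (here w≡v)   _    = w≡v
      only-v (there w∈ws) S[w] with () ← trans (sym S[w]) (count≡0⇒false (suc-injective c≡1) w∈ws)
  ... | false with count≡1⇒unique {ws} c≡1
  ...   | u , S[u] , only-u = u , S[u] , only
    where
      only : ∀ {w} → w ∈ v ∷ ws → S w ≡ true → w ≡ u
      only (here refl)  S[w] with () ← trans (sym S[w]) S[v]
      only (there w∈ws) S[w] = only-u w∈ws S[w]

  count-unique≡1 : ∀ {ws S v} → Unique ws → v ∈ ws → S v ≡ true → (∀ {w} → S w ≡ true → w ≡ v) →
                   count G ws S ≡ 1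
  count-unique≡1 {x ∷ xs} {S} (x∉xs ∷ _) (here refl) S[x] only rewrite S[x] = cong suc (count-all-false outside)
    where
      outside : ∀ {w} → w ∈ xs → S w ≡ false
      outside {w} w∈xs with S w in S[w]
      ... | false = refl
      ... | true  = ⊥-elim (All.lookup x∉xs w∈xs (sym (only S[w])))
  count-unique≡1 {x ∷ xs} {S} (x∉xs ∷ xs-unique) (there v∈xs) S[v] only with S x in S[x]
  ... | false = count-unique≡1 xs-unique v∈xs S[v] only
  ... | true  = ⊥-elim (All.lookup x∉xs v∈xs (only S[x]))

-- Zero forcing and forts

module ZeroForcing (G : Graph) where
  open Graph G

  Blue-mono : ∀ {B B′ : V → Set} → (∀ {v} → B v → B′ v) → ∀ {v} → Blue G B v → Blue G B′ v
  Blue-mono B⊆B′ (init b)              = init (B⊆B′ b)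
  Blue-mono B⊆B′ (force blue-u u~w rest) =
    force (Blue-mono B⊆B′ blue-u) u~w (λ x u~x x≢w → Blue-mono B⊆B′ (rest x u~x x≢w))

  ClosedNbhd-mono : ∀ {S T} → _⊆_ G S T → ∀ {v} → ClosedNbhd G S v → ClosedNbhd G T v
  ClosedNbhd-mono S⊆T (inj₁ S[v])             = inj₁ (S⊆T _ S[v])
  ClosedNbhd-mono S⊆T (inj₂ (s , S[s] , s~v)) = inj₂ (s , S⊆T s S[s] , s~v)

  IsPDS-mono : ∀ {S T} → _⊆_ G S T → IsPDS G S → IsPDS G T
  IsPDS-mono S⊆T pds v = Blue-mono (ClosedNbhd-mono S⊆T) (pds v)

  IsFort : (V → Set) → Set
  IsFort F = ∀ {u w} → F w → u ~ w → ¬ F u → ∃[ x ] (F x × x ≢ w × u ~ x)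

  fort-stays-white : ∀ {F B} → IsFort F → (∀ {v} → B v → ¬ F v) → ∀ {v} → Blue G B v → ¬ F v
  fort-stays-white fort B∩F=∅ (init b) = B∩F=∅ b
  fort-stays-white fort B∩F=∅ (force blue-u u~w rest) F[w]
    with fort F[w] u~w (fort-stays-white fort B∩F=∅ blue-u)
  ... | x , F[x] , x≢w , u~x = fort-stays-white fort B∩F=∅ (rest x u~x x≢w) F[x]

  fort⇒¬IsPDS : ∀ {F S w} → IsFort F → F w → (∀ {v} → ClosedNbhd G S v → ¬ F v) → ¬ IsPDS G S
  fort⇒¬IsPDS fort F[w] N[S]∩F=∅ pds = fort-stays-white fort N[S]∩F=∅ (pds _) F[w]

-- Finite graphs

record IsFinite (G : Graph) : Set where
  open Graph G
  field
    _≟_       : DecidableEquality V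
    adjacent? : ∀ u v → Dec (u ~ v)
    ∈-vs      : ∀ v → v ∈ vs
    vs-unique : Unique vs

module FiniteGraph (G : Graph) (fin : IsFinite G) where
  open Graph G
  open IsFinite fin
  open Counting G
  open ZeroForcing G

  ≐-refl : ∀ {S} → _≐_ G S S
  ≐-refl _ = refl

  ≐-sym : ∀ {S T} → _≐_ G S T → _≐_ G T S
  ≐-sym S≐T v = sym (S≐T v)

  ≐-trans : ∀ {S T U} → _≐_ G S T → _≐_ G T U → _≐_ G S U
  ≐-trans S≐T T≐U v = trans (S≐T v) (T≐U v)

  ≐⇒⊆ : ∀ {S T} → _≐_ G S T → _⊆_ G S T
  ≐⇒⊆ S≐T v S[v] = trans (sym (S≐T v)) S[v]

  ∣∣-cong : ∀ {S T} → _≐_ G S T → ∣_∣ G S ≡ ∣_∣ G T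
  ∣∣-cong S≐T = count-cong vs (λ {x} _ → S≐T x)

  IsPDS-cong : ∀ {S T} → _≐_ G S T → IsPDS G S → IsPDS G T
  IsPDS-cong S≐T = IsPDS-mono (≐⇒⊆ S≐T)

  infixl 6 _[_≔_]
  _[_≔_] : VSet G → V → Bool → VSet G
  (S [ v ≔ b ]) w = if does (w ≟ v) then b else S w

  ≔-here : ∀ S v b → (S [ v ≔ b ]) v ≡ b
  ≔-here S v b with v ≟ v
  ... | yes _   = refl
  ... | no v≢v = ⊥-elim (v≢v refl)

  ≔-there : ∀ S {v w} b → w ≢ v → (S [ v ≔ b ]) w ≡ S w
  ≔-there S {v} {w} b w≢v with w ≟ v
  ... | yes w≡v = ⊥-elim (w≢v w≡v)
  ... | no _    = refl

  ≔false-keeps-false : ∀ S v w → S w ≡ false → (S [ v ≔ false ]) w ≡ false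
  ≔false-keeps-false S v w S[w] with w ≟ v
  ... | yes _ = refl
  ... | no _  = S[w]

  ≔false-⊆ : ∀ S v → _⊆_ G (S [ v ≔ false ]) S
  ≔false-⊆ S v w S′[w] with w ≟ v
  ... | no _ = S′[w]

  ⊆-≔false : ∀ {S T} v → _⊆_ G T S → T v ≡ false → _⊆_ G T (S [ v ≔ false ])
  ⊆-≔false v T⊆S T[v] w T[w] with w ≟ v
  ... | yes refl with () ← trans (sym T[w]) T[v]
  ... | no _     = T⊆S w T[w]

  unique⇒≤∣∣ : ∀ {S} zs → Unique zs → (∀ {z} → z ∈ zs → S z ≡ true) → length zs ≤ ∣_∣ G S
  unique⇒≤∣∣ []       _                  _    = z≤n
  unique⇒≤∣∣ {S} (z ∷ zs) (z∉zs ∷ zs-unique) zs⊆S =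
    ≤-trans (s≤s (unique⇒≤∣∣ zs zs-unique in-S∖z))
            (count-< (≔false-⊆ S z) (∈-vs z) (≔-here S z false) (zs⊆S (here refl)))
    where
      in-S∖z : ∀ {w} → w ∈ zs → (S [ z ≔ false ]) w ≡ true
      in-S∖z w∈zs = trans (≔-there S false (λ w≡z → All.lookup z∉zs w∈zs (sym w≡z))) (zs⊆S (there w∈zs))

  injection⇒≤∣∣ : ∀ {m S} (f : Fin m → V) → (∀ {i j} → f i ≡ f j → i ≡ j) → (∀ i → S (f i) ≡ true) →
                  m ≤ ∣_∣ G S
  injection⇒≤∣∣ {m} {S} f f-injective f∈S =
    subst (_≤ ∣_∣ G S) (length-tabulate f)
          (unique⇒≤∣∣ (tabulate f) (Unique.tabulate⁺ f-injective)
                      (λ v∈ → let i , v≡fi = ∈-tabulate⁻ v∈ in subst (λ v → S v ≡ true) (sym v≡fi) (f∈S i)))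

-- The token addition/removal graph

module Reconfiguration (G : Graph) (fin : IsFinite G) where
  open Graph G
  open IsFinite fin
  open Counting G
  open ZeroForcing G
  open FiniteGraph G fin

  InPk-cong : ∀ {k S T} → _≐_ G S T → InPk G k S → InPk G k T
  InPk-cong {k} S≐T (pds , |S|≤k) = IsPDS-cong S≐T pds , subst (_≤ k) (∣∣-cong S≐T) |S|≤k

  TARAdj-cong : ∀ {S S′ T T′} → _≐_ G S S′ → _≐_ G T T′ → TARAdj G S T → TARAdj G S′ T′
  TARAdj-cong S≐S′ T≐T′ adj = trans (∣∣-cong (λ v → cong₂ _xor_ (sym (S≐S′ v)) (sym (T≐T′ v)))) adj

  TARAdj-sym : ∀ {S T} → TARAdj G S T → TARAdj G T S
  TARAdj-sym {S} {T} adj = trans (∣∣-cong (λ v → Bool.xor-comm (T v) (S v))) adj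

  TARAdj-≔ : ∀ S v b → S v ≢ b → TARAdj G S (S [ v ≔ b ])
  TARAdj-≔ S v b S[v]≢b = count-unique≡1 vs-unique (∈-vs v) differs-at-v only-v
    where
      differs-at-v : S v xor (S [ v ≔ b ]) v ≡ true
      differs-at-v rewrite ≔-here S v b = ≢⇒xor≡true S[v]≢b
      only-v : ∀ {w} → S w xor (S [ v ≔ b ]) w ≡ true → w ≡ v
      only-v {w} differs with w ≟ v
      ... | yes w≡v = w≡v
      ... | no _ with () ← trans (sym differs) (Bool.xor-same (S w))

  Reach-congˡ : ∀ {k S S′ T} → _≐_ G S′ S → Reach G k S T → Reach G k S′ T
  Reach-congˡ S′≐S (same S≐T)          = same (≐-trans S′≐S S≐T)
  Reach-congˡ S′≐S (step r T₀∈ T∈ adj) = step (Reach-congˡ S′≐S r) T₀∈ T∈ adj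

  Reach-congʳ : ∀ {k S T T′} → Reach G k S T → _≐_ G T T′ → Reach G k S T′
  Reach-congʳ (same S≐T)                   T≐T′ = same (≐-trans S≐T T≐T′)
  Reach-congʳ (step {T = T₀} r T₀∈ T∈ adj) T≐T′ =
    step r T₀∈ (InPk-cong T≐T′ T∈) (TARAdj-cong (≐-refl {T₀}) T≐T′ adj)

  Reach-trans : ∀ {k S T U} → Reach G k S T → Reach G k T U → Reach G k S U
  Reach-trans r (same T≐U)           = Reach-congʳ r T≐U
  Reach-trans r (step r′ T₀∈ U∈ adj) = step (Reach-trans r r′) T₀∈ U∈ adj

  Reach-sym : ∀ {k S T} → Reach G k S T → Reach G k T S
  Reach-sym (same S≐T)                           = same (≐-sym S≐T)
  Reach-sym (step {T = T₀} {U = T} r T₀∈ T∈ adj) =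
    Reach-trans (step (same (≐-refl {T})) T∈ T₀∈ (TARAdj-sym {T₀} adj)) (Reach-sym r)

  Reach-⊇ : ∀ {k S T} → _⊆_ G T S → IsPDS G T → InPk G k S → Reach G k S T
  Reach-⊇ {k} {S} {T} T⊆S pds-T S∈ = descend vs T⊆S S∈ (λ {v} _ → ∈-vs v)
    where
      Extra : VSet G → V → Set
      Extra S v = S v ≡ true × T v ≡ false

      skip : ∀ {S w ws} → (∀ {v} → Extra S v → v ∈ w ∷ ws) → ¬ Extra S w → ∀ {v} → Extra S v → v ∈ ws
      skip covers ¬extra-w extra-v with covers extra-v
      ... | here refl  = ⊥-elim (¬extra-w extra-v)
      ... | there v∈ws = v∈ws

      descend : ∀ ws {S} → _⊆_ G T S → InPk G k S → (∀ {v} → Extra S v → v ∈ ws) → Reach G k S T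
      descend [] {S} T⊆S S∈ covers = same S≐T
        where
          S≐T : _≐_ G S T
          S≐T v with S v in S[v] | T v in T[v]
          ... | true  | true  = refl
          ... | false | false = refl
          ... | true  | false with () ← covers (S[v] , T[v])
          ... | false | true  with () ← trans (sym (T⊆S v T[v])) S[v]
      descend (w ∷ ws) {S} T⊆S S∈ covers with S w in S[w] | T w in T[w]
      ... | true  | false = Reach-trans (step (same (≐-refl {S})) S∈ S′∈ S~S′) (descend ws T⊆S′ S′∈ covers′)
        where
          S′ : VSet G
          S′ = S [ w ≔ false ]
          S~S′ : TARAdj G S S′
          S~S′ = TARAdj-≔ S w false (λ S[w]≡false → true≢false (trans (sym S[w]) S[w]≡false))
          T⊆S′ : _⊆_ G T S′
          T⊆S′ = ⊆-≔false w T⊆S T[w]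
          S′∈ : InPk G k S′
          S′∈ = IsPDS-mono T⊆S′ pds-T , ≤-trans (count-mono vs (≔false-⊆ S w)) (proj₂ S∈)
          covers′ : ∀ {v} → Extra S′ v → v ∈ ws
          covers′ = skip (λ (S′[v] , T[v]) → covers (≔false-⊆ S w _ S′[v] , T[v]))
                         (λ (S′[w] , _) → true≢false (trans (sym S′[w]) (≔-here S w false)))
      ... | true  | true  = descend ws T⊆S S∈ (skip covers (λ (_ , T[w]≡false) → true≢false (trans (sym T[w]) T[w]≡false)))
      ... | false | _     = descend ws T⊆S S∈ (skip covers (λ (S[w]≡true , _) → true≢false (trans (sym S[w]≡true) S[w])))

  NoSmallerPDS : VSet G → Set
  NoSmallerPDS S = ∀ {U v} → _⊆_ G U S → S v ≡ true → U v ≡ false → ¬ IsPDS G U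

  minimal⇒NoSmallerPDS : ∀ {S} → IsMinimalPDS G S → NoSmallerPDS S
  minimal⇒NoSmallerPDS (_ , minimal) {U} {v} U⊆S S[v] U[v] pds-U =
    true≢false (trans (sym S[v]) (trans (sym (minimal U U⊆S pds-U v)) U[v]))

  Reach-from-isolated : ∀ {k S T} → ∣_∣ G S ≡ k → NoSmallerPDS S → Reach G k S T → _≐_ G T S
  Reach-from-isolated |S|≡k no-smaller (same S≐T) = ≐-sym S≐T
  Reach-from-isolated {k} {S} |S|≡k no-smaller (step {T = T₀} {U} r _ (pds-U , |U|≤k) adj)
    with Reach-from-isolated |S|≡k no-smaller r
  ... | T₀≐S with count≡1⇒unique {vs} (TARAdj-cong T₀≐S (≐-refl {U}) adj)
  ... | v , differs-at-v , only-v with S v in S[v] | U v in U[v]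
  ...   | true  | false = ⊥-elim (no-smaller U⊆S S[v] U[v] pds-U)
    where
      U⊆S : _⊆_ G U S
      U⊆S w U[w] with S w in S[w]
      ... | true  = refl
      ... | false with refl ← only-v (∈-vs w) (cong₂ _xor_ S[w] U[w]) with () ← trans (sym U[w]) U[v]
  ...   | false | true  = ⊥-elim (<-irrefl refl (≤-trans (subst (_< ∣_∣ G U) |S|≡k |S|<|U|) |U|≤k))
    where
      S⊆U : _⊆_ G S U
      S⊆U w S[w] with U w in U[w]
      ... | true  = refl
      ... | false with refl ← only-v (∈-vs w) (cong₂ _xor_ S[w] U[w]) with () ← trans (sym S[w]) S[v]
      |S|<|U| : ∣_∣ G S < ∣_∣ G U
      |S|<|U| = count-< S⊆U (∈-vs v) S[v] U[v]
  ...   | true  | true  with () ← trans (sym differs-at-v) (Bool.xor-same true)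
  ...   | false | false with () ← trans (sym differs-at-v) (Bool.xor-same false)

  isolated⇒¬PkConnected : ∀ {k S R} → ∣_∣ G S ≡ k → InPk G k S → NoSmallerPDS S →
                          InPk G k R → ¬ _≐_ G R S → ¬ PkConnected G k
  isolated⇒¬PkConnected |S|≡k S∈ no-smaller R∈ R≉S (_ , connected) =
    R≉S (Reach-from-isolated |S|≡k no-smaller (connected _ _ S∈ R∈))

  PkConnected-≥∣V∣ : ∀ {k} → length vs ≤ k → PkConnected G k
  PkConnected-≥∣V∣ {k} ∣V∣≤k = (everything , everything∈) , λ S T S∈ T∈ →
    Reach-trans (Reach-sym (Reach-⊇ (λ _ _ → refl) (proj₁ S∈) everything∈))
                (Reach-⊇ (λ _ _ → refl) (proj₁ T∈) everything∈)
    where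
      everything : VSet G
      everything _ = true
      everything∈ : InPk G k everything
      everything∈ = (λ v → init (inj₁ refl)) , ≤-trans (count≤length vs everything) ∣V∣≤k

  upper<IsPd0 : ∀ {K k₀ S} → IsUpperPd G K → IsPDS G S → ∣_∣ G S < K → IsPd0 G k₀ → K < k₀
  upper<IsPd0 {K} {k₀} {S} ((Mx , Mx-minimal , |Mx|≡K) , _) pds |S|<K (connected-from , _) with k₀ ≤? K
  ... | no k₀≰K  = ≰⇒> k₀≰K
  ... | yes k₀≤K = ⊥-elim (isolated⇒¬PkConnected |Mx|≡K (proj₁ Mx-minimal , ≤-reflexive |Mx|≡K)
                             (minimal⇒NoSmallerPDS Mx-minimal) (pds , <⇒≤ |S|<K) S≉Mx (connected-from K k₀≤K))
    where
      S≉Mx : ¬ _≐_ G S Mx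
      S≉Mx S≐Mx = <-irrefl (trans (∣∣-cong S≐Mx) |Mx|≡K) |S|<K

-- Decidability

module _ {A : Set} {P Q : A → Set} (P? : Decidable P) (Q? : Decidable Q) where

  filter-mono : ∀ xs → (∀ {x} → x ∈ xs → P x → Q x) → length (filter P? xs) ≤ length (filter Q? xs)
  filter-mono []       P⊆Q = z≤n
  filter-mono (x ∷ xs) P⊆Q with P? x | Q? x
  ... | yes _  | yes _  = s≤s (filter-mono xs (λ m → P⊆Q (there m)))
  ... | yes Px | no ¬Qx = ⊥-elim (¬Qx (P⊆Q (here refl) Px))
  ... | no _   | yes _  = m≤n⇒m≤1+n (filter-mono xs (λ m → P⊆Q (there m)))
  ... | no _   | no _   = filter-mono xs (λ m → P⊆Q (there m))

  filter-< : ∀ xs → (∀ {x} → x ∈ xs → P x → Q x) → ∀ {x} → x ∈ xs → ¬ P x → Q x →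
             length (filter P? xs) < length (filter Q? xs)
  filter-< (y ∷ xs) P⊆Q (here refl) ¬Px Qx with P? y | Q? y
  ... | yes Px | _     = ⊥-elim (¬Px Px)
  ... | no _   | no ¬Qx = ⊥-elim (¬Qx Qx)
  ... | no _   | yes _  = s≤s (filter-mono xs (λ m → P⊆Q (there m)))
  filter-< (y ∷ xs) P⊆Q (there x∈xs) ¬Px Qx with P? y | Q? y
  ... | yes _  | yes _  = s≤s (filter-< xs (λ m → P⊆Q (there m)) x∈xs ¬Px Qx)
  ... | yes Py | no ¬Qy = ⊥-elim (¬Qy (P⊆Q (here refl) Py))
  ... | no _   | yes _  = m≤n⇒m≤1+n (filter-< xs (λ m → P⊆Q (there m)) x∈xs ¬Px Qx)
  ... | no _   | no _   = filter-< xs (λ m → P⊆Q (there m)) x∈xs ¬Px Qx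

least-satisfying : ∀ {P : ℕ → Set} → Decidable P → ∀ {b} → P b → ∃[ n ] (P n × ∀ {m} → P m → n ≤ m)
least-satisfying {P} P? {b} = <-rec (λ b → P b → ∃[ n ] (P n × ∀ {m} → P m → n ≤ m)) search b
  where
    search : ∀ b → (∀ {c} → c < b → P c → ∃[ n ] (P n × ∀ {m} → P m → n ≤ m)) →
             P b → ∃[ n ] (P n × ∀ {m} → P m → n ≤ m)
    search b below Pb with anyUpTo? P? b
    ... | yes (c , c<b , Pc) = below c<b Pc
    ... | no none            = b , Pb , λ {m} Pm → ≮⇒≥ (λ m<b → none (m , m<b , Pm))

-- A chain R 0 ⊆ R 1 ⊆ … of decidable predicates whose step n + 1 is determined by step n on L is constant
-- from the first step at which it does not grow on L; since it can grow on L at most length L times,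
-- R (suc (length L)) contains every R m.
module Saturation {A : Set} (L : List A) (R : ℕ → A → Set) (R? : ∀ n → Decidable (R n))
  (R-suc : ∀ {n x} → R n x → R (suc n) x)
  (R-stable : ∀ {n} → (∀ {x} → x ∈ L → R (suc n) x → R n x) → ∀ {x} → R (suc (suc n)) x → R (suc n) x)
  where

  StableOn : ℕ → Set
  StableOn n = ∀ {x} → x ∈ L → R (suc n) x → R n x

  Stable : ℕ → Set
  Stable n = ∀ {x} → R (suc n) x → R n x

  R-mono : ∀ {m n x} → m ≤′ n → R m x → R n x
  R-mono ≤′-refl         Rx = Rx
  R-mono (≤′-step m≤′n) Rx = R-suc (R-mono m≤′n Rx)

  Stable-mono : ∀ {m n} → m ≤′ n → Stable m → Stable n
  Stable-mono ≤′-refl         st = st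
  Stable-mono (≤′-step m≤′n) st = R-stable (λ _ → Stable-mono m≤′n st)

  Stable-collapse : ∀ {m n x} → m ≤′ n → Stable m → R n x → R m x
  Stable-collapse ≤′-refl         st Rx = Rx
  Stable-collapse (≤′-step m≤′n) st Rx = Stable-collapse m≤′n st (Stable-mono m≤′n st Rx)

  private
    size : ℕ → ℕ
    size n = length (filter (R? n) L)

  stable-or-grows : ∀ n → StableOn n ⊎ size n < size (suc n)
  stable-or-grows n with any? (λ x → R? (suc n) x ×-dec ¬? (R? n x)) L
  ... | yes new = let x , x∈L , R₊x , ¬Rx = find new in
                  inj₂ (filter-< (R? n) (R? (suc n)) L (λ _ → R-suc) x∈L ¬Rx R₊x)
  ... | no none = inj₁ (λ {x} x∈L R₊x → decidable-stable (R? n x) (λ ¬Rx → none (lose x∈L (R₊x , ¬Rx))))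

  stabilises-by : ∀ n → n ≤ size n ⊎ ∃[ m ] (m < n × StableOn m)
  stabilises-by zero = inj₁ z≤n
  stabilises-by (suc n) with stabilises-by n
  ... | inj₂ (m , m<n , st) = inj₂ (m , m≤n⇒m≤1+n m<n , st)
  ... | inj₁ n≤size with stable-or-grows n
  ...   | inj₁ st   = inj₂ (n , ≤-refl , st)
  ...   | inj₂ grows = inj₁ (≤-trans (s≤s n≤size) grows)

  bound : ℕ
  bound = suc (length L)

  saturate : ∀ {m x} → R m x → R bound x
  saturate {m} Rx with stabilises-by bound
  ... | inj₁ bound≤size = ⊥-elim (<-irrefl refl (≤-trans bound≤size (length-filter (R? bound) L)))
  ... | inj₂ (s , s<bound , st) = R-mono (≤⇒≤′ s<bound) R₊x
    where
      R₊x : R (suc s) _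
      R₊x with ≤-total m (suc s)
      ... | inj₁ m≤s₊ = R-mono (≤⇒≤′ m≤s₊) Rx
      ... | inj₂ s₊≤m = Stable-collapse (≤⇒≤′ s₊≤m) (R-stable st) Rx

module Decision (G : Graph) (fin : IsFinite G) where
  open Graph G
  open IsFinite fin
  open ZeroForcing G
  open FiniteGraph G fin
  open Reconfiguration G fin

  ∀-V? : {P : V → Set} → Decidable P → Dec (∀ v → P v)
  ∀-V? P? = map′ (λ all v → All.lookup all (∈-vs v)) (λ all → All.tabulate (λ {v} _ → all v)) (all? P? vs)

  ∃-V? : {P : V → Set} → Decidable P → Dec (∃[ v ] P v)
  ∃-V? P? = map′ (λ any → let v , _ , Pv = find any in v , Pv) (λ (v , Pv) → lose (∈-vs v) Pv) (any? P? vs)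

  module _ (B : V → Set) (B? : Decidable B) where

    BlueWithin : ℕ → V → Set
    BlueWithin zero    v = B v
    BlueWithin (suc n) v = BlueWithin n v
                         ⊎ ∃[ u ] (BlueWithin n u × u ~ v × ∀ x → u ~ x → x ≢ v → BlueWithin n x)

    BlueWithin? : ∀ n → Decidable (BlueWithin n)
    BlueWithin? zero    = B?
    BlueWithin? (suc n) v = BlueWithin? n v ⊎-dec ∃-V? (λ u → BlueWithin? n u ×-dec adjacent? u v ×-dec
                              ∀-V? (λ x → adjacent? u x →-dec ¬? (x ≟ v) →-dec BlueWithin? n x))

    BlueWithin⇒Blue : ∀ {n v} → BlueWithin n v → Blue G B v
    BlueWithin⇒Blue {zero}  b                          = init b
    BlueWithin⇒Blue {suc n} (inj₁ b)                   = BlueWithin⇒Blue {n} b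
    BlueWithin⇒Blue {suc n} (inj₂ (u , bu , u~v , rest)) =
      force (BlueWithin⇒Blue {n} bu) u~v (λ x u~x x≢v → BlueWithin⇒Blue {n} (rest x u~x x≢v))

    private
      stable : ∀ {n} → (∀ {x} → x ∈ vs → BlueWithin (suc n) x → BlueWithin n x) →
               ∀ {x} → BlueWithin (suc (suc n)) x → BlueWithin (suc n) x
      stable st (inj₁ b) = b
      stable st (inj₂ (u , bu , u~v , rest)) =
        inj₂ (u , st (∈-vs u) bu , u~v , λ x u~x x≢v → st (∈-vs x) (rest x u~x x≢v))

    open Saturation vs BlueWithin BlueWithin? inj₁ (λ {n} → stable {n})

    Blue⇒BlueWithin : ∀ {v} → Blue G B v → BlueWithin bound v
    Blue⇒BlueWithin (init b)              = saturate {0} b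
    Blue⇒BlueWithin (force bu u~w rest) =
      saturate {suc bound} {_}
               (inj₂ (_ , Blue⇒BlueWithin bu , u~w , λ x u~x x≢w → Blue⇒BlueWithin (rest x u~x x≢w)))

    Blue? : Decidable (Blue G B)
    Blue? v = map′ (BlueWithin⇒Blue {bound}) Blue⇒BlueWithin (BlueWithin? bound v)

  true? : (b : Bool) → Dec (b ≡ true)
  true? b = b Bool.≟ true

  ClosedNbhd? : ∀ S → Decidable (ClosedNbhd G S)
  ClosedNbhd? S v = true? (S v) ⊎-dec ∃-V? (λ s → true? (S s) ×-dec adjacent? s v)

  IsPDS? : Decidable (IsPDS G)
  IsPDS? S = ∀-V? (Blue? (ClosedNbhd G S) (ClosedNbhd? S))

  ≐? : ∀ S T → Dec (_≐_ G S T)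
  ≐? S T = ∀-V? (λ v → S v Bool.≟ T v)

  ⊆? : ∀ S T → Dec (_⊆_ G S T)
  ⊆? S T = ∀-V? (λ v → true? (S v) →-dec true? (T v))

  subsets : List V → List (VSet G)
  subsets []       = (λ _ → false) ∷ []
  subsets (v ∷ ws) = map (_[ v ≔ false ]) (subsets ws) ++ map (_[ v ≔ true ]) (subsets ws)

  subsets-complete : ∀ ws (S : VSet G) → Σ[ T ∈ VSet G ] (T ∈ subsets ws × ∀ {w} → w ∈ ws → S w ≡ T w)
  subsets-complete []       S = _ , here refl , λ ()
  subsets-complete (v ∷ ws) S with subsets-complete ws S
  ... | T , T∈ , S≐T = T [ v ≔ S v ] , extend (S v) , agrees
    where
      extend : ∀ b → T [ v ≔ b ] ∈ subsets (v ∷ ws)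
      extend false = ∈-++⁺ˡ (∈-map⁺ (_[ v ≔ false ]) T∈)
      extend true  = ∈-++⁺ʳ _ (∈-map⁺ (_[ v ≔ true ]) T∈)
      agrees : ∀ {w} → w ∈ v ∷ ws → S w ≡ (T [ v ≔ S v ]) w
      agrees {w} w∈ with w ≟ v
      ... | yes refl = refl
      agrees (here w≡v)   | no w≢v = ⊥-elim (w≢v w≡v)
      agrees (there w∈ws) | no _   = S≐T w∈ws

  allSubsets : List (VSet G)
  allSubsets = subsets vs

  ∈-allSubsets : ∀ S → Σ[ T ∈ VSet G ] (T ∈ allSubsets × _≐_ G S T)
  ∈-allSubsets S = let T , T∈ , S≐T = subsets-complete vs S in T , T∈ , λ v → S≐T (∈-vs v)

  Respects≐ : (VSet G → Set) → Set
  Respects≐ P = ∀ {S T} → _≐_ G S T → P S → P T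

  ∀-VSet? : {P : VSet G → Set} → Respects≐ P → Decidable P → Dec (∀ S → P S)
  ∀-VSet? resp P? = map′ (λ all S → let T , T∈ , S≐T = ∈-allSubsets S in resp (≐-sym S≐T) (All.lookup all T∈))
                         (λ all → All.tabulate (λ {S} _ → all S)) (all? P? allSubsets)

  ∃-VSet? : {P : VSet G → Set} → Respects≐ P → Decidable P → Dec (∃[ S ] P S)
  ∃-VSet? resp P? = map′ (λ any → let S , _ , PS = find any in S , PS)
                         (λ (S , PS) → let T , T∈ , S≐T = ∈-allSubsets S in lose T∈ (resp S≐T PS))
                         (any? P? allSubsets)

  IsMinimalPDS-resp : Respects≐ (IsMinimalPDS G)
  IsMinimalPDS-resp S≐S′ (pds , minimal) =
    IsPDS-cong S≐S′ pds ,
    λ U U⊆S′ pds-U → ≐-trans (minimal U (λ v Uv → ≐⇒⊆ (≐-sym S≐S′) v (U⊆S′ v Uv)) pds-U) S≐S′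

  IsMinimalPDS? : Decidable (IsMinimalPDS G)
  IsMinimalPDS? S = IsPDS? S ×-dec ∀-VSet? resp (λ U → ⊆? U S →-dec IsPDS? U →-dec ≐? U S)
    where
      resp : Respects≐ (λ U → _⊆_ G U S → IsPDS G U → _≐_ G U S)
      resp U≐U′ minimal U′⊆S pds-U′ =
        ≐-trans (≐-sym U≐U′) (minimal (λ v Uv → U′⊆S v (≐⇒⊆ U≐U′ v Uv)) (IsPDS-cong (≐-sym U≐U′) pds-U′))

  IsUpperPd-exists : ∀ {S₀} → IsMinimalPDS G S₀ → ∃[ k ] IsUpperPd G k
  IsUpperPd-exists {S₀} minimal₀ = ∣_∣ G Mx , (Mx , Mx-minimal , refl) , maximal
    where
      minimals : List (VSet G)
      minimals = filter IsMinimalPDS? allSubsets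
      Mx : VSet G
      Mx = argmax (∣_∣ G) S₀ minimals
      Mx-minimal : IsMinimalPDS G Mx
      Mx-minimal = argmax-all (∣_∣ G) minimal₀ (All.all-filter IsMinimalPDS? allSubsets)
      maximal : ∀ S → IsMinimalPDS G S → ∣_∣ G S ≤ ∣_∣ G Mx
      maximal S minimal = let T , T∈ , S≐T = ∈-allSubsets S in
        subst (_≤ ∣_∣ G Mx) (sym (∣∣-cong S≐T))
              (All.lookup (f[xs]≤f[argmax] {f = ∣_∣ G} S₀ minimals)
                          (∈-filter⁺ IsMinimalPDS? T∈ (IsMinimalPDS-resp S≐T minimal)))

  InPk? : ∀ k → Decidable (InPk G k)
  InPk? k S = IsPDS? S ×-dec (∣_∣ G S ≤? k)

  TARAdj? : ∀ S T → Dec (TARAdj G S T)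
  TARAdj? S T = ∣_∣ G (λ v → S v xor T v) ℕ.≟ 1

  module _ (k : ℕ) (S : VSet G) where

    ReachWithin : ℕ → VSet G → Set
    ReachWithin zero    T = _≐_ G S T
    ReachWithin (suc n) T = ReachWithin n T
                          ⊎ Any (λ U → ReachWithin n U × InPk G k U × InPk G k T × TARAdj G U T) allSubsets

    ReachWithin? : ∀ n → Decidable (ReachWithin n)
    ReachWithin? zero    T = ≐? S T
    ReachWithin? (suc n) T = ReachWithin? n T ⊎-dec
      any? (λ U → ReachWithin? n U ×-dec InPk? k U ×-dec InPk? k T ×-dec TARAdj? U T) allSubsets

    ReachWithin⇒Reach : ∀ {n T} → ReachWithin n T → Reach G k S T
    ReachWithin⇒Reach {zero}  S≐T      = same S≐T
    ReachWithin⇒Reach {suc n} (inj₁ r) = ReachWithin⇒Reach {n} r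
    ReachWithin⇒Reach {suc n} (inj₂ any) =
      let U , _ , r , U∈ , T∈ , adj = find any in step (ReachWithin⇒Reach {n} r) U∈ T∈ adj

    ReachWithin-congʳ : ∀ {n T T′} → _≐_ G T T′ → ReachWithin n T → ReachWithin n T′
    ReachWithin-congʳ {zero}  T≐T′ S≐T      = ≐-trans S≐T T≐T′
    ReachWithin-congʳ {suc n} T≐T′ (inj₁ r) = inj₁ (ReachWithin-congʳ {n} T≐T′ r)
    ReachWithin-congʳ {suc n} T≐T′ (inj₂ any) =
      let U , U∈L , r , U∈ , T∈ , adj = find any in
      inj₂ (lose U∈L (r , U∈ , InPk-cong T≐T′ T∈ , TARAdj-cong (≐-refl {U}) T≐T′ adj))

    private
      stable : ∀ {n} → (∀ {T} → T ∈ allSubsets → ReachWithin (suc n) T → ReachWithin n T) →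
               ∀ {T} → ReachWithin (suc (suc n)) T → ReachWithin (suc n) T
      stable st (inj₁ r)   = r
      stable st (inj₂ any) = let U , U∈L , r , rest = find any in inj₂ (lose U∈L (st U∈L r , rest))

    open Saturation allSubsets ReachWithin ReachWithin? inj₁ (λ {n} → stable {n})

    Reach⇒ReachWithin : ∀ {T} → Reach G k S T → ReachWithin bound T
    Reach⇒ReachWithin (same S≐T) = saturate {0} S≐T
    Reach⇒ReachWithin (step {T = T₀} r T₀∈ T∈ adj) =
      let U , U∈L , T₀≐U = ∈-allSubsets T₀ in
      saturate {suc bound} (inj₂ (lose U∈L (ReachWithin-congʳ T₀≐U (Reach⇒ReachWithin r) ,
                                            InPk-cong T₀≐U T₀∈ , T∈ , TARAdj-cong T₀≐U (≐-refl {_}) adj)))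

    Reach? : Decidable (Reach G k S)
    Reach? T = map′ (ReachWithin⇒Reach {bound}) Reach⇒ReachWithin (ReachWithin? bound T)

  PkConnected? : Decidable (PkConnected G)
  PkConnected? k = ∃-VSet? (InPk-cong {k}) (InPk? k) ×-dec ∀-VSet? from-resp (λ S → ∀-VSet? to-resp (λ T →
                     InPk? k S →-dec InPk? k T →-dec Reach? k S T))
    where
      from-resp : Respects≐ (λ S → ∀ T → InPk G k S → InPk G k T → Reach G k S T)
      from-resp S≐S′ reach T S′∈ T∈ = Reach-congˡ (≐-sym S≐S′) (reach T (InPk-cong (≐-sym S≐S′) S′∈) T∈)
      to-resp : ∀ {S} → Respects≐ (λ T → InPk G k S → InPk G k T → Reach G k S T)
      to-resp T≐T′ reach S∈ T′∈ = Reach-congʳ (reach S∈ (InPk-cong (≐-sym T≐T′) T′∈)) T≐T′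

  ConnectedFrom : ℕ → Set
  ConnectedFrom k₀ = ∀ k → k₀ ≤ k → PkConnected G k

  ConnectedFrom? : Decidable ConnectedFrom
  ConnectedFrom? k₀ = map′ extend (λ conn {k} _ → conn k) (allUpTo? (λ k → k₀ ≤? k →-dec PkConnected? k) (length vs))
    where
      extend : (∀ {k} → k < length vs → k₀ ≤ k → PkConnected G k) → ConnectedFrom k₀
      extend conn k k₀≤k with k <? length vs
      ... | yes k<∣V∣ = conn k<∣V∣ k₀≤k
      ... | no  k≮∣V∣ = PkConnected-≥∣V∣ (≮⇒≥ k≮∣V∣)

  IsPd0-exists : ∃[ k ] IsPd0 G k
  IsPd0-exists = let k₀ , conn , least = least-satisfying ConnectedFrom? {length vs} (λ k → PkConnected-≥∣V∣)
                 in k₀ , conn , λ k₁ conn₁ → least conn₁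

-- Finite sums

sum-map-concatMap : ∀ {A B : Set} (f : B → ℕ) (g : A → List B) xs →
                    sum (map f (concatMap g xs)) ≡ sum (map (λ x → sum (map f (g x))) xs)
sum-map-concatMap f g []       = refl
sum-map-concatMap f g (x ∷ xs) = begin
  sum (map f (g x ++ concatMap g xs))                   ≡⟨ cong sum (map-++ f (g x) _) ⟩
  sum (map f (g x) ++ map f (concatMap g xs))           ≡⟨ sum-++ (map f (g x)) _ ⟩
  sum (map f (g x)) + sum (map f (concatMap g xs))      ≡⟨ cong (sum (map f (g x)) +_) (sum-map-concatMap f g xs) ⟩
  sum (map f (g x)) + sum (map (λ x → sum (map f (g x))) xs) ∎
  where open ≡-Reasoning

∑< : ℕ → (ℕ → ℕ) → ℕ
∑< zero    f = 0
∑< (suc n) f = f 0 + ∑< n (λ m → f (suc m))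

sum-map-allFin : ∀ n (f : ℕ → ℕ) → sum (map (λ i → f (toℕ i)) (allFin n)) ≡ ∑< n f
sum-map-allFin n f = trans (cong sum (map-tabulate {n = n} (λ i → i) (λ i → f (toℕ i)))) (sum-tabulate n f)
  where
    sum-tabulate : ∀ n (f : ℕ → ℕ) → sum (tabulate {n = n} (λ i → f (toℕ i))) ≡ ∑< n f
    sum-tabulate zero    f = refl
    sum-tabulate (suc n) f = cong (f 0 +_) (sum-tabulate n (λ m → f (suc m)))

∑<-cong : ∀ n {f g : ℕ → ℕ} → (∀ m → f m ≡ g m) → ∑< n f ≡ ∑< n g
∑<-cong zero    f≗g = refl
∑<-cong (suc n) f≗g = cong₂ _+_ (f≗g 0) (∑<-cong n (λ m → f≗g (suc m)))

∑<-+ : ∀ n (f g : ℕ → ℕ) → ∑< n (λ m → f m + g m) ≡ ∑< n f + ∑< n g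
∑<-+ zero    f g = refl
∑<-+ (suc n) f g = trans (cong (f 0 + g 0 +_) (∑<-+ n (λ m → f (suc m)) (λ m → g (suc m)))) (interchange (f 0) (g 0) _ _)
  where
    interchange : ∀ a b c d → a + b + (c + d) ≡ a + c + (b + d)
    interchange = solve-∀

∑<-*ʳ : ∀ n (f : ℕ → ℕ) c → ∑< n (λ m → f m * c) ≡ ∑< n f * c
∑<-*ʳ zero    f c = refl
∑<-*ʳ (suc n) f c = trans (cong (f 0 * c +_) (∑<-*ʳ n (λ m → f (suc m)) c)) (sym (*-distribʳ-+ c (f 0) _))

∑<-const : ∀ n c → ∑< n (λ _ → c) ≡ n * c
∑<-const zero    c = refl
∑<-const (suc n) c = cong (c +_) (∑<-const n c)

triangle : ℕ → ℕ
triangle n = ∑< n (λ m → m)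

triangle-suc : ∀ n → triangle (suc n) ≡ n + triangle n
triangle-suc n = trans (∑<-+ n (λ _ → 1) (λ m → m)) (cong (_+ triangle n) (trans (∑<-const n 1) (*-identityʳ n)))

triangle*2 : ∀ n → triangle n * 2 ≡ n * (n ∸ 1)
triangle*2 zero    = refl
triangle*2 (suc n) = begin
  triangle (suc n) * 2      ≡⟨ cong (_* 2) (triangle-suc n) ⟩
  (n + triangle n) * 2      ≡⟨ *-distribʳ-+ 2 n (triangle n) ⟩
  n * 2 + triangle n * 2    ≡⟨ cong (n * 2 +_) (triangle*2 n) ⟩
  n * 2 + n * (n ∸ 1)       ≡⟨ expand n ⟩
  suc n * n                 ∎
  where
    open ≡-Reasoning
    expand : ∀ n → n * 2 + n * (n ∸ 1) ≡ suc n * n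
    expand zero    = refl
    expand (suc n) = ring n
      where
        ring : ∀ n → suc n * 2 + suc n * n ≡ suc (suc n) * suc n
        ring = solve-∀

triangle≡choose2 : ∀ n → n * (n ∸ 1) / 2 ≡ triangle n
triangle≡choose2 n = trans (cong (_/ 2) (sym (triangle*2 n))) (m*n/n≡m (triangle n) 2)

-- The graph K^{2,q}(K_r)

Unique-concatMap : ∀ {A B : Set} (f : A → List B) {xs} → Unique xs → (∀ x → Unique (f x)) →
                   (∀ {x y} → x ≢ y → Disjoint (f x) (f y)) → Unique (concatMap f xs)
Unique-concatMap f xs-unique f-unique f-disjoint =
  Unique.concat⁺ (All.map⁺ (All.tabulate (λ {x} _ → f-unique x)))
                 (AllPairs.map⁺ (AllPairs.map f-disjoint xs-unique))

Disjoint-map : ∀ {A B C : Set} (g : A → C) (h : B → C) {xs ys} → (∀ a b → g a ≢ h b) → Disjoint (map g xs) (map h ys)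
Disjoint-map g h g≢h (v∈gxs , v∈hys) with ∈-map⁻ g v∈gxs | ∈-map⁻ h v∈hys
... | a , _ , refl | b , _ , ga≡hb = g≢h a b ga≡hb

module Subdivision (r q : ℕ) where

  H : Graph
  H = K2q (Kr r) q

  open Graph H using (V; vs; _~_)

  E : Set
  E = EdgeGraph.E (Kr r)

  lo hi : E → Fin r
  lo = EdgeGraph.end₁ (Kr r)
  hi = EdgeGraph.end₂ (Kr r)

  Endpoint : Fin r → E → Set
  Endpoint a e = (a ≡ lo e) ⊎ (a ≡ hi e)

  pattern orig a   = inj₁ a
  pattern sub e k = inj₂ (e , k)

  _≟E_ : (e e′ : E) → Dec (e ≡ e′)
  _≟E_ = Product.≡-dec Fin._≟_ Fin._≟_

  _≟V_ : (v w : V) → Dec (v ≡ w)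
  _≟V_ = Sum.≡-dec Fin._≟_ (Product.≡-dec _≟E_ Fin._≟_)

  adjacent? : ∀ u v → Dec (u ~ v)
  adjacent? (orig a)   (orig b)   = no λ ()
  adjacent? (sub _ _) (sub _ _) = no λ ()
  adjacent? (orig a)   (sub e k) = endpoint? a e
    where
      endpoint? : ∀ a e → Dec (Endpoint a e)
      endpoint? a e with a Fin.≟ lo e | a Fin.≟ hi e
      ... | yes a≡lo | _        = yes (inj₁ a≡lo)
      ... | no _     | yes a≡hi = yes (inj₂ a≡hi)
      ... | no a≢lo  | no a≢hi  = no λ { (inj₁ a≡lo) → a≢lo a≡lo ; (inj₂ a≡hi) → a≢hi a≡hi }
  adjacent? (sub e k) (orig a)   = adjacent? (orig a) (sub e k)

  edgesAt : Fin r → List E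
  edgesAt j = map (j ,_) (allFin (toℕ j))

  subdivisions : E → List V
  subdivisions e = map (sub e) (allFin q)

  es : List E
  es = concatMap edgesAt (allFin r)

  ∈-es : ∀ e → e ∈ es
  ∈-es (j , i) = ∈-concatMap⁺ edgesAt (lose (∈-allFin j) (∈-map⁺ (j ,_) (∈-allFin i)))

  es-unique : Unique es
  es-unique = Unique-concatMap edgesAt (Unique.allFin⁺ r)
    (λ j → Unique.map⁺ (λ { refl → refl }) (Unique.allFin⁺ (toℕ j)))
    (λ j≢j′ → Disjoint-map _ _ (λ _ _ eq → j≢j′ (cong proj₁ eq)))

  ∈-vs : ∀ v → v ∈ vs
  ∈-vs (orig a)   = ∈-++⁺ˡ (∈-map⁺ orig (∈-allFin a))
  ∈-vs (sub e k) = ∈-++⁺ʳ _ (∈-concatMap⁺ subdivisions (lose (∈-es e) (∈-map⁺ (sub e) (∈-allFin k))))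

  ∈-subdivisions⁻ : ∀ {v} → v ∈ concatMap subdivisions es → ∃[ e ] ∃[ k ] v ≡ sub e k
  ∈-subdivisions⁻ v∈ with Any.satisfied (∈-concatMap⁻ subdivisions {xs = es} v∈)
  ... | e , v∈sub-e with ∈-map⁻ (sub e) v∈sub-e
  ...   | k , _ , v≡sub = e , k , v≡sub

  vs-unique : Unique vs
  vs-unique = Unique.++⁺ (Unique.map⁺ (λ { refl → refl }) (Unique.allFin⁺ r))
    (Unique-concatMap subdivisions es-unique (λ e → Unique.map⁺ (λ { refl → refl }) (Unique.allFin⁺ q))
                      (λ e≢e′ → Disjoint-map _ _ (λ _ _ eq → e≢e′ (cong proj₁ (Sum.inj₂-injective eq)))))
    originals∩subdivisions=∅
    where
      originals∩subdivisions=∅ : Disjoint (map orig (allFin r)) (concatMap subdivisions es)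
      originals∩subdivisions=∅ (v∈originals , v∈subdivisions) with ∈-map⁻ orig v∈originals
      ... | _ , _ , refl with ∈-subdivisions⁻ v∈subdivisions
      ...   | _ , _ , ()

  finite : IsFinite H
  finite = record { _≟_ = _≟V_ ; adjacent? = adjacent? ; ∈-vs = ∈-vs ; vs-unique = vs-unique }

  toℕ-lo : ∀ e → toℕ (lo e) ≡ toℕ (proj₂ e)
  toℕ-lo (j , i) = toℕ-inject≤ i _

  lo<hi : ∀ e → toℕ (lo e) < toℕ (hi e)
  lo<hi (j , i) rewrite toℕ-lo (j , i) = toℕ<n i

  lo≢hi : ∀ e → lo e ≢ hi e
  lo≢hi e lo≡hi = <-irrefl (cong toℕ lo≡hi) (lo<hi e)

  edge-≡ : ∀ {e e′} → hi e ≡ hi e′ → toℕ (proj₂ e) ≡ toℕ (proj₂ e′) → e ≡ e′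
  edge-≡ {j , i} {.j , i′} refl i≡i′ with refl ← toℕ-injective i≡i′ = refl

  Joins : E → Fin r → Fin r → Set
  Joins e a b = (lo e ≡ a × hi e ≡ b) ⊎ (lo e ≡ b × hi e ≡ a)

  edge-between : ∀ {a b} → a ≢ b → Σ[ e ∈ E ] Joins e a b
  edge-between {a} {b} a≢b with <-cmp (toℕ a) (toℕ b)
  ... | tri< a<b _ _ = (b , fromℕ< a<b) , inj₁ (toℕ-injective (trans (toℕ-inject≤ _ _) (toℕ-fromℕ< a<b)) , refl)
  ... | tri≈ _ a≡b _ = ⊥-elim (a≢b (toℕ-injective a≡b))
  ... | tri> _ _ b<a = (a , fromℕ< b<a) , inj₂ (toℕ-injective (trans (toℕ-inject≤ _ _) (toℕ-fromℕ< b<a)) , refl)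

  Joins-sym : ∀ {e a b} → Joins e a b → Joins e b a
  Joins-sym (inj₁ ends) = inj₂ ends
  Joins-sym (inj₂ ends) = inj₁ ends

  Joins-endpointˡ : ∀ {e a b} → Joins e a b → Endpoint a e
  Joins-endpointˡ (inj₁ (refl , _)) = inj₁ refl
  Joins-endpointˡ (inj₂ (_ , refl)) = inj₂ refl

  endpoint-Joins : ∀ {e a b c} → Endpoint c e → Joins e a b → c ≡ a ⊎ c ≡ b
  endpoint-Joins (inj₁ refl) (inj₁ (refl , _)) = inj₁ refl
  endpoint-Joins (inj₂ refl) (inj₁ (_ , refl)) = inj₂ refl
  endpoint-Joins (inj₁ refl) (inj₂ (refl , _)) = inj₂ refl
  endpoint-Joins (inj₂ refl) (inj₂ (_ , refl)) = inj₁ refl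

  Joins-functional : ∀ {e a b c} → Joins e a b → Joins e a c → b ≡ c
  Joins-functional (inj₁ (_ , refl)) (inj₁ (_ , refl)) = refl
  Joins-functional (inj₂ (refl , _)) (inj₂ (refl , _)) = refl
  Joins-functional {e} (inj₁ (refl , _)) (inj₂ (_ , hi≡a)) = ⊥-elim (lo≢hi e (sym hi≡a))
  Joins-functional {e} (inj₂ (_ , refl)) (inj₁ (lo≡a , _)) = ⊥-elim (lo≢hi e lo≡a)

  sub-injective : ∀ {e e′} {k k′ : Fin q} → _≡_ {A = V} (sub e k) (sub e′ k′) → e ≡ e′ × k ≡ k′
  sub-injective refl = refl , refl

  sub≢sub : ∀ {e e′ a b c} {k k′ : Fin q} → Joins e a b → Joins e′ a c → b ≢ c → _≢_ {A = V} (sub e k) (sub e′ k′)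
  sub≢sub J J′ b≢c eq with refl ← proj₁ (sub-injective eq) = b≢c (Joins-functional J J′)

  open ZeroForcing H

  sub∉N[S] : ∀ {S e k} → S (sub e k) ≡ false → S (orig (lo e)) ≡ false → S (orig (hi e)) ≡ false →
             ¬ ClosedNbhd H S (sub e k)
  sub∉N[S] S[v] _     _     (inj₁ S[v]′)                      = true≢false (trans (sym S[v]′) S[v])
  sub∉N[S] _    S[lo] _     (inj₂ (orig _ , S[lo]′ , inj₁ refl)) = true≢false (trans (sym S[lo]′) S[lo])
  sub∉N[S] _    _     S[hi] (inj₂ (orig _ , S[hi]′ , inj₂ refl)) = true≢false (trans (sym S[hi]′) S[hi])

  pair-fort : ∀ {e k k′} → k ≢ k′ → IsFort (λ v → v ≡ sub e k ⊎ v ≡ sub e k′)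
  pair-fort {e} {k} {k′} k≢k′ {orig _} (inj₁ refl) c~w _ =
    sub e k′ , inj₂ refl , (λ eq → k≢k′ (sym (proj₂ (sub-injective eq)))) , c~w
  pair-fort {e} {k} {k′} k≢k′ {orig _} (inj₂ refl) c~w _ =
    sub e k , inj₁ refl , (λ eq → k≢k′ (proj₂ (sub-injective eq))) , c~w

  uncovered-edge : ∀ {S e k k′} → IsPDS H S → S (orig (lo e)) ≡ false → S (orig (hi e)) ≡ false →
                   S (sub e k) ≡ false → k′ ≢ k → S (sub e k′) ≡ true
  uncovered-edge {S} {e} {k} {k′} pds S[lo] S[hi] S[k] k′≢k with S (sub e k′) in S[k′]
  ... | true  = refl
  ... | false = ⊥-elim (fort⇒¬IsPDS (pair-fort k′≢k) (inj₁ refl) white pds)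
    where
      white : ∀ {v} → ClosedNbhd H S v → ¬ (v ≡ sub e k′ ⊎ v ≡ sub e k)
      white N[S]v (inj₁ refl) = sub∉N[S] S[k′] S[lo] S[hi] N[S]v
      white N[S]v (inj₂ refl) = sub∉N[S] S[k] S[lo] S[hi] N[S]v

  triangle-fort : ∀ {a b c eab ebc eca k₁ k₂ k₃} → a ≢ b → b ≢ c → c ≢ a →
                  Joins eab a b → Joins ebc b c → Joins eca c a →
                  IsFort (λ v → v ≡ sub eab k₁ ⊎ v ≡ sub ebc k₂ ⊎ v ≡ sub eca k₃)
  triangle-fort a≢b b≢c c≢a Jab Jbc Jca {orig x} (inj₁ refl) x~w _
    with endpoint-Joins x~w Jab
  ... | inj₁ refl =
    _ , inj₂ (inj₂ refl) , sub≢sub (Joins-sym Jca) Jab (λ c≡b → b≢c (sym c≡b)) , Joins-endpointˡ (Joins-sym Jca)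
  ... | inj₂ refl = _ , inj₂ (inj₁ refl) , sub≢sub Jbc (Joins-sym Jab) c≢a , Joins-endpointˡ Jbc
  triangle-fort a≢b b≢c c≢a Jab Jbc Jca {orig x} (inj₂ (inj₁ refl)) x~w _
    with endpoint-Joins x~w Jbc
  ... | inj₁ refl =
    _ , inj₁ refl , sub≢sub (Joins-sym Jab) Jbc (λ a≡c → c≢a (sym a≡c)) , Joins-endpointˡ (Joins-sym Jab)
  ... | inj₂ refl = _ , inj₂ (inj₂ refl) , sub≢sub Jca (Joins-sym Jbc) a≢b , Joins-endpointˡ Jca
  triangle-fort a≢b b≢c c≢a Jab Jbc Jca {orig x} (inj₂ (inj₂ refl)) x~w _
    with endpoint-Joins x~w Jca
  ... | inj₁ refl =
    _ , inj₂ (inj₁ refl) , sub≢sub (Joins-sym Jbc) Jca (λ b≡a → a≢b (sym b≡a)) , Joins-endpointˡ (Joins-sym Jbc)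
  ... | inj₂ refl = _ , inj₁ refl , sub≢sub Jab (Joins-sym Jca) b≢c , Joins-endpointˡ Jab
module K2qKr (n′ q′ : ℕ) where

  n r q : ℕ
  n = suc (suc n′)
  r = suc n
  q = suc (suc (suc (suc q′)))

  open Subdivision r q public
  open Graph H using (V; vs; _~_)
  open Counting H
  open ZeroForcing H
  open FiniteGraph H finite
  open Reconfiguration H finite

  ℓ₀ ℓ₁ ℓ₂ ℓ₃ : Fin q
  ℓ₀ = Fin.zero
  ℓ₁ = Fin.suc Fin.zero
  ℓ₂ = Fin.suc (Fin.suc Fin.zero)
  ℓ₃ = Fin.suc (Fin.suc (Fin.suc Fin.zero))

  Joins-missing : ∀ {S : VSet H} {e a b} → Joins e a b → S (orig a) ≡ false → S (orig b) ≡ false →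
                  S (orig (lo e)) ≡ false × S (orig (hi e)) ≡ false
  Joins-missing (inj₁ (refl , refl)) S[a] S[b] = S[a] , S[b]
  Joins-missing (inj₂ (refl , refl)) S[a] S[b] = S[b] , S[a]

  module _ {S : VSet H} (pds : IsPDS H S) {e} (S[lo] : S (orig (lo e)) ≡ false) (S[hi] : S (orig (hi e)) ≡ false) where

    private
      except : ∀ {k k′} → S (sub e k) ≡ false → k′ ≢ k → S (sub e k′) ≡ true
      except = uncovered-edge pds S[lo] S[hi]

    covered : Σ[ k ∈ Fin q ] S (sub e k) ≡ true
    covered with S (sub e ℓ₀) in S[0]
    ... | true  = ℓ₀ , S[0]
    ... | false = ℓ₁ , except S[0] (λ ())

    thrice-covered : Σ[ k₁ ∈ Fin q ] Σ[ k₂ ∈ Fin q ] Σ[ k₃ ∈ Fin q ]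
                       (k₁ ≢ k₂ × k₁ ≢ k₃ × k₂ ≢ k₃ × S (sub e k₁) ≡ true × S (sub e k₂) ≡ true × S (sub e k₃) ≡ true)
    thrice-covered with S (sub e ℓ₀) in S[0] | S (sub e ℓ₁) in S[1] | S (sub e ℓ₂) in S[2]
    ... | false | _     | _     =
      ℓ₁ , ℓ₂ , ℓ₃ , (λ ()) , (λ ()) , (λ ()) , except S[0] (λ ()) , except S[0] (λ ()) , except S[0] (λ ())
    ... | true  | false | _     = ℓ₀ , ℓ₂ , ℓ₃ , (λ ()) , (λ ()) , (λ ()) , S[0] , except S[1] (λ ()) , except S[1] (λ ())
    ... | true  | true  | false = ℓ₀ , ℓ₁ , ℓ₃ , (λ ()) , (λ ()) , (λ ()) , S[0] , S[1] , except S[2] (λ ())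
    ... | true  | true  | true  = ℓ₀ , ℓ₁ , ℓ₂ , (λ ()) , (λ ()) , (λ ()) , S[0] , S[1] , S[2]

  opposite : Fin r → V → Fin r
  opposite a (orig c)   = c
  opposite a (sub e _) = if does (lo e Fin.≟ a) then hi e else lo e

  opposite-sub : ∀ {e a b k} → Joins e a b → b ≢ a → opposite a (sub e k) ≡ b
  opposite-sub {e} {a} (inj₁ (lo≡a , hi≡b)) _ with lo e Fin.≟ a
  ... | yes _    = hi≡b
  ... | no lo≢a = ⊥-elim (lo≢a lo≡a)
  opposite-sub {e} {a} (inj₂ (lo≡b , hi≡a)) b≢a with lo e Fin.≟ a
  ... | yes lo≡a = ⊥-elim (b≢a (trans (sym lo≡b) lo≡a))
  ... | no _     = lo≡b

  module _ {S : VSet H} (pds : IsPDS H S) {a} (S[a] : S (orig a) ≡ false) where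

    witness : ∀ {b} → b ≢ a → Σ[ v ∈ V ] (S v ≡ true × opposite a v ≡ b)
    witness {b} b≢a with S (orig b) in S[b]
    ... | true  = orig b , S[b] , refl
    ... | false = let e , J = edge-between (λ a≡b → b≢a (sym a≡b))
                      S[lo] , S[hi] = Joins-missing {S} J S[a] S[b]
                      k , S[k] = covered pds S[lo] S[hi]
                  in sub e k , S[k] , opposite-sub {k = k} J b≢a

    witnesses : Fin n → V
    witnesses i = proj₁ (witness (punchInᵢ≢i a i))

    witnesses-injective : ∀ {i j} → witnesses i ≡ witnesses j → i ≡ j
    witnesses-injective {i} {j} eq = punchIn-injective a i j (begin
      punchIn a i                  ≡⟨ sym (proj₂ (proj₂ (witness (punchInᵢ≢i a i)))) ⟩
      opposite a (witnesses i)     ≡⟨ cong (opposite a) eq ⟩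
      opposite a (witnesses j)     ≡⟨ proj₂ (proj₂ (witness (punchInᵢ≢i a j))) ⟩
      punchIn a j                  ∎)
      where open ≡-Reasoning

  n≤∣PDS∣ : ∀ {S} → IsPDS H S → n ≤ ∣_∣ H S
  n≤∣PDS∣ {S} pds with Fin.any? (λ a → S (orig a) Bool.≟ false)
  ... | yes (a , S[a]) = injection⇒≤∣∣ {S = S} (witnesses pds S[a]) (witnesses-injective pds S[a])
                                        (λ i → proj₁ (proj₂ (witness pds S[a] (punchInᵢ≢i a i))))
  ... | no none        = ≤-trans (n≤1+n n) (injection⇒≤∣∣ {S = S} orig (λ { refl → refl }) in-S)
    where
      in-S : ∀ a → S (orig a) ≡ true
      in-S a = Bool.¬-not (λ S[a] → none (a , S[a]))

  two-originals-missing⇒r<∣∣ : ∀ {S a b} → IsPDS H S → a ≢ b → S (orig a) ≡ false → S (orig b) ≡ false → r < ∣_∣ H S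
  two-originals-missing⇒r<∣∣ {S} {a} {b} pds a≢b S[a] S[b] with edge-between a≢b
  ... | e , J with Joins-missing {S} J S[a] S[b]
  ... | S[lo] , S[hi] with thrice-covered pds S[lo] S[hi]
  ... | k₁ , k₂ , k₃ , k₁≢k₂ , k₁≢k₃ , k₂≢k₃ , S[k₁] , S[k₂] , S[k₃] =
    subst (λ m → suc (suc m) ≤ ∣_∣ H S) (length-tabulate w) (unique⇒≤∣∣ zs zs-unique zs⊆S)
    where
      b≢a : b ≢ a
      b≢a b≡a = a≢b (sym b≡a)

      -- The witness for b is sub e k₁, so sub e k₂ and sub e k₃ give two more elements of S: r + 1 in all.
      witness′ : ∀ {c} → c ≢ a → Σ[ v ∈ V ] (S v ≡ true × opposite a v ≡ c × (c ≡ b → v ≡ sub e k₁))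
      witness′ {c} c≢a with c Fin.≟ b
      ... | yes refl = sub e k₁ , S[k₁] , opposite-sub {k = k₁} J b≢a , λ _ → refl
      ... | no c≢b   = let v , S[v] , v↦c = witness pds S[a] c≢a in v , S[v] , v↦c , λ c≡b → ⊥-elim (c≢b c≡b)

      w : Fin n → V
      w i = proj₁ (witness′ (punchInᵢ≢i a i))

      w↦punchIn : ∀ i → opposite a (w i) ≡ punchIn a i
      w↦punchIn i = proj₁ (proj₂ (proj₂ (witness′ (punchInᵢ≢i a i))))

      w-injective : ∀ {i j} → w i ≡ w j → i ≡ j
      w-injective {i} {j} eq = punchIn-injective a i j (trans (sym (w↦punchIn i)) (trans (cong (opposite a) eq) (w↦punchIn j)))

      w≢sub : ∀ {k} → k ≢ k₁ → ∀ i → sub e k ≢ w i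
      w≢sub {k} k≢k₁ i sub≡w = k≢k₁ (proj₂ (sub-injective (trans sub≡w w≡sub-k₁)))
        where
          punchIn≡b : punchIn a i ≡ b
          punchIn≡b = trans (sym (w↦punchIn i)) (trans (cong (opposite a) (sym sub≡w)) (opposite-sub {k = k} J b≢a))
          w≡sub-k₁ : w i ≡ sub e k₁
          w≡sub-k₁ = proj₂ (proj₂ (proj₂ (witness′ (punchInᵢ≢i a i)))) punchIn≡b

      zs : List V
      zs = sub e k₂ ∷ sub e k₃ ∷ tabulate w

      zs-unique : Unique zs
      zs-unique = ((λ eq → k₂≢k₃ (proj₂ (sub-injective eq))) ∷ All.tabulate⁺ (w≢sub (λ k₂≡k₁ → k₁≢k₂ (sym k₂≡k₁))))
                ∷ All.tabulate⁺ (w≢sub (λ k₃≡k₁ → k₁≢k₃ (sym k₃≡k₁)))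
                ∷ Unique.tabulate⁺ w-injective

      zs⊆S : ∀ {z} → z ∈ zs → S z ≡ true
      zs⊆S (here refl)         = S[k₂]
      zs⊆S (there (here refl)) = S[k₃]
      zs⊆S (there (there z∈))  with ∈-tabulate⁻ {f = w} z∈
      ... | i , refl = proj₁ (proj₂ (witness′ (punchInᵢ≢i a i)))

  Originals : VSet H
  Originals (orig _)   = true
  Originals (sub _ _) = false

  Originals∖ : Fin r → VSet H
  Originals∖ c = Originals [ orig c ≔ false ]

  Originals∖-orig : ∀ c {c′} → c′ ≢ c → Originals∖ c (orig c′) ≡ true
  Originals∖-orig c {c′} c′≢c = ≔-there Originals {orig c} {orig c′} false (λ { refl → c′≢c refl })

  Originals∖⊆Originals : ∀ c → _⊆_ H (Originals∖ c) Originals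
  Originals∖⊆Originals c v v∈ with v ≟V orig c
  ... | no _ = v∈

  Originals∖-N[sub] : ∀ c e k → ClosedNbhd H (Originals∖ c) (sub e k)
  Originals∖-N[sub] c e k with hi e Fin.≟ c
  ... | no hi≢c   = inj₂ (orig (hi e) , Originals∖-orig c hi≢c , inj₂ refl)
  ... | yes refl = inj₂ (orig (lo e) , Originals∖-orig c (lo≢hi e) , inj₁ refl)

  Originals∖-pds : ∀ c → IsPDS H (Originals∖ c)
  Originals∖-pds c (sub e k) = init (Originals∖-N[sub] c e k)
  Originals∖-pds c (orig c′) with c′ Fin.≟ c
  ... | no c′≢c = init (inj₁ (Originals∖-orig c c′≢c))
  ... | yes refl with edge-between {c} {punchIn c Fin.zero} (λ c≡ → punchInᵢ≢i c Fin.zero (sym c≡))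
  ...   | e , J = force (init (Originals∖-N[sub] c e ℓ₀)) (Joins-endpointˡ J) others
    where
      others : ∀ x → sub e ℓ₀ ~ x → x ≢ orig c → Blue H (ClosedNbhd H (Originals∖ c)) x
      others (orig x) _ x≢c = init (inj₁ (Originals∖-orig c {x} (λ { refl → x≢c refl })))

  ∣Originals∣ : ∣_∣ H Originals ≡ r
  ∣Originals∣ = begin
    count H (map orig (allFin r) ++ concatMap subdivisions es) Originals
      ≡⟨ count-++ (map orig (allFin r)) _ Originals ⟩
    count H (map orig (allFin r)) Originals + count H (concatMap subdivisions es) Originals
      ≡⟨ cong₂ _+_ (count-all-true originals) (count-all-false subdivisions-only) ⟩
    length (map orig (allFin r)) + 0
      ≡⟨ +-identityʳ _ ⟩
    length (map orig (allFin r))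
      ≡⟨ length-map orig (allFin r) ⟩
    length (allFin r)
      ≡⟨ length-tabulate id ⟩
    r ∎
    where
      open ≡-Reasoning
      originals : ∀ {v} → v ∈ map orig (allFin r) → Originals v ≡ true
      originals v∈ with ∈-map⁻ orig v∈
      ... | _ , _ , refl = refl
      subdivisions-only : ∀ {v} → v ∈ concatMap subdivisions es → Originals v ≡ false
      subdivisions-only v∈ with ∈-subdivisions⁻ v∈
      ... | _ , _ , refl = refl

  ∣Originals∖∣ : ∀ c → ∣_∣ H (Originals∖ c) ≡ n
  ∣Originals∖∣ c = ≤-antisym (ℕ.s≤s⁻¹ (subst (∣_∣ H (Originals∖ c) <_) ∣Originals∣ smaller)) (n≤∣PDS∣ (Originals∖-pds c))
    where
      smaller : ∣_∣ H (Originals∖ c) < ∣_∣ H Originals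
      smaller = count-< (Originals∖⊆Originals c) (∈-vs (orig c)) (≔-here Originals (orig c) false) refl

  small-PDS-shape : ∀ {S} → IsPDS H S → ∣_∣ H S ≤ r → _⊆_ H Originals S ⊎ ∃[ a ] _⊆_ H (Originals∖ a) S
  small-PDS-shape {S} pds |S|≤r with Fin.any? (λ a → S (orig a) Bool.≟ false)
  ... | no none = inj₁ Originals⊆S
    where
      Originals⊆S : _⊆_ H Originals S
      Originals⊆S (orig a) _ = Bool.¬-not (λ S[a] → none (a , S[a]))
  ... | yes (a , S[a]) with Fin.any? (λ b → ¬? (b Fin.≟ a) ×-dec S (orig b) Bool.≟ false)
  ...   | yes (b , b≢a , S[b]) =
    ⊥-elim (<-irrefl refl (≤-trans (two-originals-missing⇒r<∣∣ pds (λ a≡b → b≢a (sym a≡b)) S[a] S[b]) |S|≤r))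
  ...   | no none = inj₂ (a , Originals∖a⊆S)
    where
      Originals∖a⊆S : _⊆_ H (Originals∖ a) S
      Originals∖a⊆S (orig b) b∈ with b Fin.≟ a
      ... | no b≢a = Bool.¬-not (λ S[b] → none (b , b≢a , S[b]))

  Originals-pds : IsPDS H Originals
  Originals-pds = IsPDS-mono (Originals∖⊆Originals Fin.zero) (Originals∖-pds Fin.zero)

  Originals∈Pr : InPk H r Originals
  Originals∈Pr = Originals-pds , ≤-reflexive ∣Originals∣

  Originals∖∈Pk : ∀ {k} c → n ≤ k → InPk H k (Originals∖ c)
  Originals∖∈Pk c n≤k = Originals∖-pds c , subst (_≤ _) (sym (∣Originals∖∣ c)) n≤k

  Reach-Originals : ∀ {S} → InPk H r S → Reach H r S Originals
  Reach-Originals S∈@(pds , |S|≤r) with small-PDS-shape pds |S|≤r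
  ... | inj₁ Originals⊆S       = Reach-⊇ Originals⊆S Originals-pds S∈
  ... | inj₂ (a , Originals∖⊆S) =
    step (Reach-⊇ Originals∖⊆S (Originals∖-pds a) S∈) (Originals∖∈Pk a (n≤1+n n)) Originals∈Pr
         (TARAdj-sym {Originals} {Originals∖ a} (TARAdj-≔ Originals (orig a) false (λ ())))

  Pr-connected : PkConnected H r
  Pr-connected = (Originals , Originals∈Pr) ,
                 λ S T S∈ T∈ → Reach-trans (Reach-Originals S∈) (Reach-sym (Reach-Originals T∈))

  Originals∖-NoSmallerPDS : ∀ c → NoSmallerPDS (Originals∖ c)
  Originals∖-NoSmallerPDS c {U} U⊆S S[v] U[v] pds-U =
    <-irrefl refl (≤-trans (subst (∣_∣ H U <_) (∣Originals∖∣ c) (count-< U⊆S (∈-vs _) U[v] S[v])) (n≤∣PDS∣ pds-U))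

  IsLowerPd0-r : IsLowerPd0 H r
  IsLowerPd0-r = Pr-connected , least
    where
      c₀ c₁ : Fin r
      c₀ = Fin.zero
      c₁ = Fin.suc Fin.zero
      differ : ¬ _≐_ H (Originals∖ c₁) (Originals∖ c₀)
      differ O₁≐O₀ =
        true≢false (trans (sym (Originals∖-orig c₁ {c₀} (λ ()))) (trans (O₁≐O₀ (orig c₀)) (≔-here Originals (orig c₀) false)))
      least : ∀ j → PkConnected H j → r ≤ j
      least j conn@((S , pds , |S|≤j) , _) with r ℕ.≤? j
      ... | yes r≤j = r≤j
      ... | no r≰j  = ⊥-elim (isolated⇒¬PkConnected (trans (∣Originals∖∣ c₀) (sym j≡n)) (Originals∖∈Pk c₀ n≤j)
                                (Originals∖-NoSmallerPDS c₀) (Originals∖∈Pk c₁ n≤j) differ conn)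
        where
          n≤j : n ≤ j
          n≤j = ≤-trans (n≤∣PDS∣ pds) |S|≤j
          j≡n : j ≡ n
          j≡n = ≤-antisym (ℕ.s≤s⁻¹ (≰⇒> r≰j)) n≤j

  touches₀ : E → Bool
  touches₀ (_ , i) = toℕ i ℕ.≡ᵇ 0

  touches₀⇒ : ∀ {e} → touches₀ e ≡ true → toℕ (proj₂ e) ≡ 0
  touches₀⇒ {_ , i} t with toℕ i | t
  ... | zero  | _  = refl
  ... | suc _ | ()

  touches₀⇐ : ∀ {e} → toℕ (proj₂ e) ≡ 0 → touches₀ e ≡ true
  touches₀⇐ {_ , i} i≡0 rewrite i≡0 = refl

  Joins-0⇒touches₀ : ∀ {e a} → Joins e a Fin.zero → touches₀ e ≡ true
  Joins-0⇒touches₀ {e} (inj₁ (_ , hi≡0)) with () ← subst (λ c → toℕ (lo e) < toℕ c) hi≡0 (lo<hi e)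
  Joins-0⇒touches₀ {e} (inj₂ (lo≡0 , _)) = touches₀⇐ (trans (sym (toℕ-lo e)) (cong toℕ lo≡0))

  M : VSet H
  M (orig _)            = false
  M (sub e Fin.zero)    = not (touches₀ e)
  M (sub _ (Fin.suc _)) = true

  M-blue-orig : ∀ c → Blue H (ClosedNbhd H M) (orig c)
  M-blue-orig c with edge-between {c} {punchIn c Fin.zero} (λ c≡ → punchInᵢ≢i c Fin.zero (sym c≡))
  ... | e , J = init (inj₂ (sub e ℓ₁ , refl , Joins-endpointˡ J))

  M-pds : IsPDS H M
  M-pds (orig c)              = M-blue-orig c
  M-pds (sub e (Fin.suc _))   = init (inj₁ refl)
  M-pds (sub e Fin.zero) with touches₀ e in t
  ... | false = init (inj₁ (cong not t))
  ... | true  = force (M-blue-orig (hi e)) (inj₂ refl) others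
    where
      others : ∀ x → orig (hi e) ~ x → x ≢ sub e ℓ₀ → Blue H (ClosedNbhd H M) x
      others (sub e′ (Fin.suc _)) _ _ = init (inj₁ refl)
      others (sub e′ Fin.zero) hi~e′ x≢ with touches₀ e′ in t′ | hi~e′
      ... | false | _            = init (inj₁ (cong not t′))
      ... | true  | inj₁ hi≡lo′ = ⊥-elim (n≮0 (subst (toℕ (lo e) <_) hi≡0 (lo<hi e)))
        where
          hi≡0 : toℕ (hi e) ≡ 0
          hi≡0 = trans (cong toℕ hi≡lo′) (trans (toℕ-lo e′) (touches₀⇒ t′))
      ... | true  | inj₂ hi≡hi′ = ⊥-elim (x≢ (cong (λ e → sub e ℓ₀) (sym e≡e′)))
        where
          e≡e′ : e ≡ e′
          e≡e′ = edge-≡ hi≡hi′ (trans (touches₀⇒ t) (sym (touches₀⇒ t′)))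

  N[M∖v]-misses : ∀ v {e k} → M (sub e k) ≡ false ⊎ sub e k ≡ v → ¬ ClosedNbhd H (M [ v ≔ false ]) (sub e k)
  N[M∖v]-misses v {e} {k} out = sub∉N[S] (M∖v[x] out) (no-orig (lo e)) (no-orig (hi e))
    where
      no-orig : ∀ c → (M [ v ≔ false ]) (orig c) ≡ false
      no-orig c = ≔false-keeps-false M v (orig c) refl
      M∖v[x] : M (sub e k) ≡ false ⊎ sub e k ≡ v → (M [ v ≔ false ]) (sub e k) ≡ false
      M∖v[x] (inj₁ M[x]) = ≔false-keeps-false M v (sub e k) M[x]
      M∖v[x] (inj₂ refl) = ≔-here M v false

  M∖v-¬IsPDS : ∀ v → M v ≡ true → ¬ IsPDS H (M [ v ≔ false ])
  M∖v-¬IsPDS v@(sub e k) M[v] pds with touches₀ e in t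
  ... | true  = fort⇒¬IsPDS (pair-fort k≢ℓ₀) (inj₁ refl) white pds
    where
      k≢ℓ₀ : k ≢ ℓ₀
      k≢ℓ₀ refl = true≢false (trans (sym M[v]) (cong not t))
      white : ∀ {x} → ClosedNbhd H (M [ v ≔ false ]) x → ¬ (x ≡ v ⊎ x ≡ sub e ℓ₀)
      white N[x] (inj₁ refl) = N[M∖v]-misses v (inj₂ refl) N[x]
      white N[x] (inj₂ refl) = N[M∖v]-misses v (inj₁ (cong not t)) N[x]
  ... | false = fort⇒¬IsPDS (triangle-fort (lo≢hi e) hi≢0 0≢lo (inj₁ (refl , refl)) J-hi0 J-0lo) (inj₁ refl) white pds
    where
      hi≢0 : hi e ≢ Fin.zero
      hi≢0 hi≡0 = n≮0 (subst (λ c → toℕ (lo e) < toℕ c) hi≡0 (lo<hi e))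
      0≢lo : Fin.zero ≢ lo e
      0≢lo 0≡lo = true≢false (trans (sym (touches₀⇐ (trans (sym (toℕ-lo e)) (cong toℕ (sym 0≡lo))))) t)
      e-hi0 = proj₁ (edge-between hi≢0)
      J-hi0 = proj₂ (edge-between hi≢0)
      e-0lo = proj₁ (edge-between 0≢lo)
      J-0lo = proj₂ (edge-between 0≢lo)
      white : ∀ {x} → ClosedNbhd H (M [ v ≔ false ]) x → ¬ (x ≡ v ⊎ x ≡ sub e-hi0 ℓ₀ ⊎ x ≡ sub e-0lo ℓ₀)
      white N[x] (inj₁ refl)        = N[M∖v]-misses v (inj₂ refl) N[x]
      white N[x] (inj₂ (inj₁ refl)) = N[M∖v]-misses v (inj₁ (cong not (Joins-0⇒touches₀ J-hi0))) N[x]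
      white N[x] (inj₂ (inj₂ refl)) = N[M∖v]-misses v (inj₁ (cong not (Joins-0⇒touches₀ (Joins-sym J-0lo)))) N[x]

  M-minimal : IsMinimalPDS H M
  M-minimal = M-pds , λ T T⊆M pds-T v → agree T T⊆M pds-T v
    where
      agree : ∀ T → _⊆_ H T M → IsPDS H T → ∀ v → T v ≡ M v
      agree T T⊆M pds-T v with M v in M[v] | T v in T[v]
      ... | true  | true  = refl
      ... | false | false = refl
      ... | false | true  = ⊥-elim (true≢false (trans (sym (T⊆M v T[v])) M[v]))
      ... | true  | false = ⊥-elim (M∖v-¬IsPDS v M[v] (IsPDS-mono T⊆M∖v pds-T))
        where
          T⊆M∖v : _⊆_ H T (M [ v ≔ false ])
          T⊆M∖v w T[w] with w ≟V v
          ... | yes refl = ⊥-elim (true≢false (trans (sym T[w]) T[v]))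
          ... | no _     = T⊆M w T[w]

  q₀ : ℕ
  q₀ = suc (suc (suc q′))

  weight : ℕ → ℕ
  weight i = if i ℕ.≡ᵇ 0 then q₀ else q

  count-subdivisions-M : ∀ e → count H (subdivisions e) M ≡ weight (toℕ (proj₂ e))
  count-subdivisions-M e = begin
    (if not (touches₀ e) then suc (count H later M) else count H later M)
      ≡⟨ cong (λ c → if not (touches₀ e) then suc c else c) later-count ⟩
    (if not (touches₀ e) then q else q₀)
      ≡⟨ if-not (touches₀ e) ⟩
    (if touches₀ e then q₀ else q) ∎
    where
      open ≡-Reasoning
      later : List V
      later = map (sub e) (tabulate {n = q₀} Fin.suc)
      later-count : count H later M ≡ q₀
      later-count = trans (count-all-true in-M)
                          (trans (length-map (sub e) (tabulate {n = q₀} Fin.suc)) (length-tabulate {n = q₀} Fin.suc))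
        where
          in-M : ∀ {x} → x ∈ later → M x ≡ true
          in-M x∈ with ∈-map⁻ (sub e) x∈
          ... | k , k∈ , refl with ∈-tabulate⁻ {f = Fin.suc} k∈
          ...   | _ , refl = refl
      if-not : ∀ b → (if not b then q else q₀) ≡ (if b then q₀ else q)
      if-not true  = refl
      if-not false = refl

  ∣M∣ : ∣_∣ H M ≡ ∑< r (λ j → ∑< j weight)
  ∣M∣ = begin
    count H (map orig (allFin r) ++ concatMap subdivisions es) M
      ≡⟨ count-++ (map orig (allFin r)) _ M ⟩
    count H (map orig (allFin r)) M + count H (concatMap subdivisions es) M
      ≡⟨ cong (_+ count H (concatMap subdivisions es) M) (count-all-false no-originals) ⟩
    count H (concatMap subdivisions es) M
      ≡⟨ count-concatMap subdivisions es M ⟩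
    sum (map (λ e → count H (subdivisions e) M) es)
      ≡⟨ cong sum (map-cong count-subdivisions-M es) ⟩
    sum (map (λ e → weight (toℕ (proj₂ e))) es)
      ≡⟨ sum-map-concatMap (λ e → weight (toℕ (proj₂ e))) edgesAt (allFin r) ⟩
    sum (map (λ j → sum (map (λ e → weight (toℕ (proj₂ e))) (edgesAt j))) (allFin r))
      ≡⟨ cong sum (map-cong row (allFin r)) ⟩
    sum (map (λ j → ∑< (toℕ j) weight) (allFin r))
      ≡⟨ sum-map-allFin r (λ j → ∑< j weight) ⟩
    ∑< r (λ j → ∑< j weight) ∎
    where
      open ≡-Reasoning
      no-originals : ∀ {x} → x ∈ map orig (allFin r) → M x ≡ false
      no-originals x∈ with ∈-map⁻ orig x∈
      ... | _ , _ , refl = refl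
      row : ∀ j → sum (map (λ e → weight (toℕ (proj₂ e))) (edgesAt j)) ≡ ∑< (toℕ j) weight
      row j = trans (cong sum (sym (map-∘ (allFin (toℕ j))))) (sum-map-allFin (toℕ j) weight)

  ∣M∣+n : ∣_∣ H M + n ≡ q * triangle r
  ∣M∣+n = begin
    ∣_∣ H M + n                                     ≡⟨ cong (_+ n) ∣M∣ ⟩
    ∑< n (λ j → q₀ + ∑< j (λ _ → q)) + n            ≡⟨ cong (_+ n) (∑<-+ n (λ _ → q₀) (λ j → ∑< j (λ _ → q))) ⟩
    ∑< n (λ _ → q₀) + ∑< n (λ j → ∑< j (λ _ → q)) + n
      ≡⟨ cong (λ x → x + n) (cong₂ _+_ (∑<-const n q₀) (trans (∑<-cong n (λ j → ∑<-const j q)) (∑<-*ʳ n (λ j → j) q))) ⟩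
    n * q₀ + triangle n * q + n                      ≡⟨ ring n (triangle n) ⟩
    q * (n + triangle n)                             ≡⟨ cong (q *_) (sym (triangle-suc n)) ⟩
    q * triangle r                                   ∎
    where
      open ≡-Reasoning
      ring : ∀ n t → n * q₀ + t * q + n ≡ q * (n + t)
      ring = solve-∀

  choose2-bound≡∣M∣ : q * (r * (r ∸ 1) / 2) ∸ (r ∸ 1) ≡ ∣_∣ H M
  choose2-bound≡∣M∣ = begin
    q * (r * n / 2) ∸ n      ≡⟨ cong (λ t → q * t ∸ n) (triangle≡choose2 r) ⟩
    q * triangle r ∸ n       ≡⟨ cong (_∸ n) (sym ∣M∣+n) ⟩
    ∣_∣ H M + n ∸ n          ≡⟨ m+n∸n≡m (∣_∣ H M) n ⟩
    ∣_∣ H M                  ∎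
    where open ≡-Reasoning

  r≤∣M∣ : r ≤ ∣_∣ H M
  r≤∣M∣ = +-cancelʳ-≤ n r (∣_∣ H M) (begin
    r + n             ≤⟨ +-monoʳ-≤ r (n≤1+n n) ⟩
    r + r             ≤⟨ +-monoʳ-≤ r (m≤m+n r _) ⟩
    q * r             ≤⟨ *-monoʳ-≤ q r≤triangle ⟩
    q * triangle r    ≡⟨ sym ∣M∣+n ⟩
    ∣_∣ H M + n       ∎)
    where
      open ≤-Reasoning
      r≤triangle : r ≤ triangle r
      r≤triangle = subst (r ≤_) (sym (triangle-suc n)) (subst (_≤ n + triangle n) (+-comm n 1) (+-monoʳ-≤ n (s≤s z≤n)))

proposition3p17 : (r q : ℕ) → 3 ≤ r → 4 ≤ q →
    IsPd (K2q (Kr r) q) (r ∸ 1)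
    × (∃[ k ] (IsUpperPd (K2q (Kr r) q) k × q * (r * (r ∸ 1) / 2) ∸ (r ∸ 1) ≤ k))
    × IsLowerPd0 (K2q (Kr r) q) r
    × (∃[ k ] (IsPd0 (K2q (Kr r) q) k × suc (q * (r * (r ∸ 1) / 2) ∸ (r ∸ 1)) ≤ k))
    × r < suc (q * (r * (r ∸ 1) / 2) ∸ (r ∸ 1))
proposition3p17 (suc (suc (suc n′))) (suc (suc (suc (suc q′)))) (s≤s (s≤s (s≤s z≤n))) (s≤s (s≤s (s≤s (s≤s z≤n)))) =
  IsPd-n , (K , upper , bound≤K) , IsLowerPd0-r , (k₀ , pd0 , ≤-trans (s≤s bound≤K) K<k₀) , s≤s r≤bound
  where
    open K2qKr n′ q′
    open Reconfiguration H finite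
    open Decision H finite

    c₀ : Fin r
    c₀ = Fin.zero

    IsPd-n : IsPd H n
    IsPd-n = (Originals∖ c₀ , Originals∖-pds c₀ , ∣Originals∖∣ c₀) , λ _ → n≤∣PDS∣

    K = proj₁ (IsUpperPd-exists M-minimal)
    upper = proj₂ (IsUpperPd-exists M-minimal)
    k₀ = proj₁ IsPd0-exists
    pd0 = proj₂ IsPd0-exists

    ∣M∣≤K : ∣_∣ H M ≤ K
    ∣M∣≤K = proj₂ upper M M-minimal

    bound≤K = subst (_≤ K) (sym choose2-bound≡∣M∣) ∣M∣≤K
    r≤bound = subst (r ≤_) (sym choose2-bound≡∣M∣) r≤∣M∣

    K<k₀ : K < k₀
    K<k₀ = upper<IsPd0 upper (Originals∖-pds c₀) (subst (_< K) (sym (∣Originals∖∣ c₀)) (≤-trans r≤∣M∣ ∣M∣≤K)) pd0
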